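{- Let $\Pi_q$ be a projective plane of order $q$. For every integer $r$ with $4\le r\le\frac{q+7}{3}$ there exists a minimal percolating set $A_r$ (for $r$-neighbor line percolation) whose percolation time is exactly $3$, i.e. $A_r^2\ne\mathcal P$ and $A_r^3=\mathcal P$.
   Context: A finite projective plane $\Pi_q$ of order $q\ge 2$ has point set $\mathcal P$ of size $q^2+q+1$ and $q^2+q+1$ lines; every line contains $q+1$ points, every point lies on $q+1$ lines, any two lines meet in exactly one point and any two points lie on exactly one line. $r$-neighbor line percolation: for a set $A$ of points let $A^0=A$ and for $s\ge1$ let $A^s=A^{s-1}\cup\{P: \exists \text{ line } l\ni P \text{ with } |l\cap A^{s-1}|\ge r\}$; $A$ percolates if $A^k=\mathcal P$ for some $k$, and the percolation time of $A$ is the least such $k$. A percolating set is minimal if none of its proper subsets percolates. -}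

module Defs where

open import Data.Nat using (ℕ; zero; suc; _+_; _*_; _≤ᵇ_)
open import Data.Bool using (Bool; true; false; _∨_; _∧_)
open import Data.Fin using (Fin)
open import Data.Fin.Subset using (Subset; ∣_∣; _∩_; _⊂_; ⊤)
open import Data.Vec using (tabulate; lookup)
open import Data.Vec.Functional using () renaming (foldr to foldrF)
open import Data.Product using (Σ; _×_; ∃)
open import Relation.Binary.PropositionalEquality using (_≡_; _≢_)
open import Relation.Nullary using (¬_)

size : ℕ → ℕ
size q = q * q + q + 1

-- A finite projective plane of order q ≥ 2: points and lines are both
-- indexed by Fin (q²+q+1); `inc P l ≡ true` means point P lies on line l.
record ProjectivePlane (q : ℕ) : Set where
  field
    q≥2      : 2 Data.Nat.≤ q
    inc      : Fin (size q) → Fin (size q) → Bool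
  pointsOn : Fin (size q) → Subset (size q)
  pointsOn l = tabulate (λ P → inc P l)
  linesThrough : Fin (size q) → Subset (size q)
  linesThrough P = tabulate (λ l → inc P l)
  field
    lineSize   : ∀ l → ∣ pointsOn l ∣ ≡ suc q
    pointDeg   : ∀ P → ∣ linesThrough P ∣ ≡ suc q
    linesMeet  : ∀ l m → l ≢ m →
                 Σ (Fin (size q)) λ P → (inc P l ≡ true × inc P m ≡ true)
                   × (∀ P′ → inc P′ l ≡ true → inc P′ m ≡ true → P′ ≡ P)
    pointsJoin : ∀ P Q → P ≢ Q →
                 Σ (Fin (size q)) λ l → (inc P l ≡ true × inc Q l ≡ true)
                   × (∀ l′ → inc P l′ ≡ true → inc Q l′ ≡ true → l′ ≡ l)

module Percolation {q : ℕ} (Π : ProjectivePlane q) (r : ℕ) where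
  open ProjectivePlane Π

  -- is there a line l through P with |l ∩ A| ≥ r ?
  activated : Subset (size q) → Fin (size q) → Bool
  activated A P =
    foldrF (λ l b → (inc P l ∧ (r ≤ᵇ ∣ pointsOn l ∩ A ∣)) ∨ b) false (λ l → l)

  step : Subset (size q) → Subset (size q)
  step A = tabulate (λ P → lookup A P ∨ activated A P)

  iter : ℕ → Subset (size q) → Subset (size q)
  iter zero    A = A
  iter (suc s) A = step (iter s A)

  Percolates : Subset (size q) → Set
  Percolates A = ∃ λ k → iter k A ≡ ⊤

  MinimalPercolating : Subset (size q) → Set
  MinimalPercolating A = Percolates A × (∀ B → B ⊂ A → ¬ Percolates B)

module Submission where

-- For q ≥ 2r − 2 (which 3r ≤ q + 7 gives unless r = 4 and q = 5) take r − 2 lines L through a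
-- point O, r − 1 further points on each of them, a point Y off the L, two lines K through Y and a
-- line W through O meeting the K in a₀, a₁; A consists of O, Y, a₀, a₁ and the points on the L.
-- Let S be the union of the L and {Y, a₀, a₁}.  Another line through O contains at most three
-- points of S, a K only two points of A, and any other line meets the L in r − 2 points and
-- {Y, a₀, a₁} in at most one; so exactly the L fill at time 1.  At time 2 the K fill (Y, a_i and
-- their r − 2 meets with the L), while a point x ≠ O, Y of the line OY is still missing.  Any
-- other point y lies on one of its q + 1 > 2r − 2 lines avoiding O, Y and the 2(r − 2) points of
-- K ∩ L; that line meets the r filled lines in r distinct points, so y is infected at time 3.
--
-- For q = 5, r = 4 take four lines in general position, A their six vertices and one more point on
-- each line.  At time 1 the four lines fill, at time 2 every line through no vertex.  Through a
-- point of a diagonal the six vertices span only five of its six lines, so the diagonals are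
-- infected at time 2; the line joining any remaining point to a vertex meets the other two lines
-- and a diagonal in three more infected points.  The point left over on a suitable line through a
-- vertex is still missing at time 2, since its six lines all pass through vertices.
--
-- Minimality: for each a ∈ A some union of lines and points contains A − a but not a, and every
-- other line meets it in fewer than r points; this closed set bounds what A − a can infect.

open import Defs
open import Data.Nat using (ℕ; _≤_; _*_; _+_)
open import Data.Fin.Subset using (Subset; ⊤)
open import Data.Product using (Σ; _×_)
open import Relation.Binary.PropositionalEquality using (_≡_; _≢_)

module Counting where

  open import Data.Bool using (Bool; true; false)
  open import Data.Empty using (⊥-elim)
  open import Data.Fin using (Fin; zero; suc; _↑ˡ_; _↑ʳ_; splitAt; inject≤; _≟_)
  open import Data.Fin.Properties
    using (any?; injective⇒≤; splitAt-↑ˡ; splitAt-↑ʳ; suc-injective; inject≤-injective)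
  open import Data.Fin.Subset using (Subset; _∈_; ∣_∣; _∩_; ∁)
  open import Data.Fin.Subset.Properties using (x∈p∩q⁺; x∈p∩q⁻; x∉p⇒x∈∁p; x∈∁p⇒x∉p)
  open import Data.Nat using (ℕ; suc; _+_; _≤_)
  open import Data.Nat.Properties using (+-cancelˡ-≤; ≤-trans; 1+n≰n)
  open import Data.Product using (Σ; ∃; _×_; _,_; proj₁; proj₂)
  open import Data.Sum using ([_,_]′)
  open import Data.Vec using (_∷_; here; there; tabulate)
  open import Data.Vec.Functional using () renaming (_∷_ to _∷ᶠ_)
  open import Data.Vec.Properties using (lookup∘tabulate; []=⇒lookup; lookup⇒[]=)
  open import Function using (_∘_)
  open import Function.Definitions using (Injective)
  open import Relation.Binary.PropositionalEquality using (_≡_; _≢_; refl; sym; trans; cong)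
  open import Relation.Nullary using (Dec; yes; no)
  open import Relation.Nullary.Decidable using (⌊_⌋)
  open import Relation.Unary using (Decidable)

  private variable
    N j k : ℕ

  ∈-tabulate⁺ : (f : Fin N → Bool) {x : Fin N} → f x ≡ true → x ∈ tabulate f
  ∈-tabulate⁺ f {x} fx = lookup⇒[]= x (tabulate f) (trans (lookup∘tabulate f x) fx)

  ∈-tabulate⁻ : (f : Fin N → Bool) {x : Fin N} → x ∈ tabulate f → f x ≡ true
  ∈-tabulate⁻ f {x} x∈ = trans (sym (lookup∘tabulate f x)) ([]=⇒lookup x∈)

  subset : {P : Fin N → Set} → Decidable P → Subset N
  subset P? = tabulate (λ x → ⌊ P? x ⌋)

  module _ {P : Fin N → Set} (P? : Decidable P) where

    ∈-subset⁺ : ∀ {x} → P x → x ∈ subset P?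
    ∈-subset⁺ {x} Px = ∈-tabulate⁺ (λ y → ⌊ P? y ⌋) (true-if x Px)
      where
      true-if : ∀ x → P x → ⌊ P? x ⌋ ≡ true
      true-if x Px with P? x
      ... | yes _  = refl
      ... | no ¬Px = ⊥-elim (¬Px Px)

    ∈-subset⁻ : ∀ {x} → x ∈ subset P? → P x
    ∈-subset⁻ {x} x∈ = sound (P? x) (∈-tabulate⁻ (λ y → ⌊ P? y ⌋) x∈)
      where
      sound : (d : Dec (P x)) → ⌊ d ⌋ ≡ true → P x
      sound (yes Px) _ = Px

  enum : (S : Subset N) → Fin ∣ S ∣ → Fin N
  enum (true  ∷ S) zero    = zero
  enum (true  ∷ S) (suc i) = suc (enum S i)
  enum (false ∷ S) i       = suc (enum S i)

  enum-∈ : (S : Subset N) (i : Fin ∣ S ∣) → enum S i ∈ S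
  enum-∈ (true  ∷ S) zero    = here
  enum-∈ (true  ∷ S) (suc i) = there (enum-∈ S i)
  enum-∈ (false ∷ S) i       = there (enum-∈ S i)

  enum-injective : (S : Subset N) → Injective _≡_ _≡_ (enum S)
  enum-injective (true  ∷ S) {zero}  {zero}  _  = refl
  enum-injective (true  ∷ S) {suc i} {suc j} eq = cong suc (enum-injective S (suc-injective eq))
  enum-injective (false ∷ S) eq = enum-injective S (suc-injective eq)

  enum-surjective : (S : Subset N) {x : Fin N} → x ∈ S → ∃ λ i → enum S i ≡ x
  enum-surjective (true ∷ S) here = zero , refl
  enum-surjective (true ∷ S) (there x∈) with enum-surjective S x∈
  ... | i , eq = suc i , cong suc eq
  enum-surjective (false ∷ S) (there x∈) with enum-surjective S x∈
  ... | i , eq = i , cong suc eq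

  injective⇒≤∣p∣ : (S : Subset N) (f : Fin k → Fin N) → Injective _≡_ _≡_ f →
                   (∀ i → f i ∈ S) → k ≤ ∣ S ∣
  injective⇒≤∣p∣ S f f-inj f∈ = injective⇒≤ {f = index} index-inj
    where
    index : _ → Fin ∣ S ∣
    index i = proj₁ (enum-surjective S (f∈ i))
    index-inj : Injective _≡_ _≡_ index
    index-inj {i} {i′} eq = f-inj (trans (sym (proj₂ (enum-surjective S (f∈ i))))
                                  (trans (cong (enum S) eq) (proj₂ (enum-surjective S (f∈ i′)))))

  covered⇒∣p∣≤ : (S : Subset N) (g : Fin k → Fin N) →
                 (∀ {x} → x ∈ S → ∃ λ i → g i ≡ x) → ∣ S ∣ ≤ k
  covered⇒∣p∣≤ S g cover = injective⇒≤ {f = preimage} preimage-inj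
    where
    preimage : Fin ∣ S ∣ → _
    preimage i = proj₁ (cover (enum-∈ S i))
    preimage-inj : Injective _≡_ _≡_ preimage
    preimage-inj {i} {i′} eq = enum-injective S (trans (sym (proj₂ (cover (enum-∈ S i))))
                                 (trans (cong g eq) (proj₂ (cover (enum-∈ S i′)))))

  ∷-injective : {A : Set} {x : A} {f : Fin k → A} → Injective _≡_ _≡_ f → (∀ i → f i ≢ x) →
                Injective _≡_ _≡_ (x ∷ᶠ f)
  ∷-injective f-inj f≢x {zero}  {zero}  _  = refl
  ∷-injective f-inj f≢x {zero}  {suc i} eq = ⊥-elim (f≢x i (sym eq))
  ∷-injective f-inj f≢x {suc i} {zero}  eq = ⊥-elim (f≢x i eq)
  ∷-injective f-inj f≢x {suc i} {suc i′} eq = cong suc (f-inj eq)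

  injective⇒covers : (S : Subset N) (f : Fin k → Fin N) → Injective _≡_ _≡_ f →
                     (∀ i → f i ∈ S) → ∣ S ∣ ≤ k → ∀ {y} → y ∈ S → ∃ λ i → f i ≡ y
  injective⇒covers {k = k} S f f-inj f∈ ∣S∣≤k {y} y∈S with any? (λ i → f i ≟ y)
  ... | yes hit = hit
  ... | no miss = ⊥-elim (1+n≰n (≤-trans (injective⇒≤∣p∣ S f′ f′-inj f′∈) ∣S∣≤k))
    where
    f′ : Fin (suc k) → _
    f′ = y ∷ᶠ f
    f′-inj : Injective _≡_ _≡_ f′
    f′-inj = ∷-injective f-inj λ i eq → miss (i , eq)
    f′∈ : ∀ i → f′ i ∈ S
    f′∈ zero    = y∈S
    f′∈ (suc i) = f∈ i

  abstract
    choose : ∀ k (S : Subset N) (g : Fin j → Fin N) → j + k ≤ ∣ S ∣ →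
             Σ (Fin k → Fin N) λ f → Injective _≡_ _≡_ f × (∀ i → f i ∈ S) × (∀ i i′ → g i′ ≢ f i)
    choose {N = N} {j = j} k S g j+k≤∣S∣ = f , f-inj , f∈S , f∉g
      where
      in-image : Fin N → Set
      in-image x = ∃ λ i → g i ≡ x
      in-image? : Decidable in-image
      in-image? x = any? (λ i → g i ≟ x)
      S′ : Subset N
      S′ = S ∩ ∁ (subset in-image?)
      listing : Fin (j + ∣ S′ ∣) → Fin N
      listing i = [ g , enum S′ ]′ (splitAt j i)
      listing-covers : ∀ {x} → x ∈ S → ∃ λ i → listing i ≡ x
      listing-covers {x} x∈S with in-image? x
      ... | yes (i , gi≡x) = i ↑ˡ ∣ S′ ∣ , trans (cong [ g , enum S′ ]′ (splitAt-↑ˡ j i ∣ S′ ∣)) gi≡x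
      ... | no x∉g with enum-surjective S′ (x∈p∩q⁺ (x∈S , x∉p⇒x∈∁p (x∉g ∘ ∈-subset⁻ in-image?)))
      ...   | i , eq = j ↑ʳ i , trans (cong [ g , enum S′ ]′ (splitAt-↑ʳ j ∣ S′ ∣ i)) eq
      k≤∣S′∣ : k ≤ ∣ S′ ∣
      k≤∣S′∣ = +-cancelˡ-≤ j k ∣ S′ ∣ (≤-trans j+k≤∣S∣ (covered⇒∣p∣≤ S listing listing-covers))
      f : Fin k → Fin N
      f i = enum S′ (inject≤ i k≤∣S′∣)
      f-inj : Injective _≡_ _≡_ f
      f-inj eq = inject≤-injective k≤∣S′∣ k≤∣S′∣ _ _ (enum-injective S′ eq)
      f∈S′ : ∀ i → f i ∈ S′
      f∈S′ i = enum-∈ S′ (inject≤ i k≤∣S′∣)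
      f∈S : ∀ i → f i ∈ S
      f∈S i = proj₁ (x∈p∩q⁻ S _ (f∈S′ i))
      f∉g : ∀ i i′ → g i′ ≢ f i
      f∉g i i′ eq = x∈∁p⇒x∉p (proj₂ (x∈p∩q⁻ S _ (f∈S′ i))) (∈-subset⁺ in-image? (i′ , eq))

module Geometry {q : ℕ} (Π : ProjectivePlane q) where

  open Counting
  open import Data.Bool using (Bool; true; false; _∧_; _∨_; T)
  import Data.Bool as Bool
  open import Data.Empty using (⊥; ⊥-elim)
  open import Data.Fin using (Fin; zero; suc; _≟_; fromℕ<; _↑ˡ_; _↑ʳ_)
  open import Data.Fin.Properties using (any?; all?; splitAt-↑ˡ; splitAt-↑ʳ)
  import Data.Nat as ℕ
  open import Data.Fin.Subset using (Subset; _∈_; _∉_; _⊆_; _⊂_; ∣_∣; _∩_; ⊤)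
  open import Data.Fin.Subset.Properties
    using (_∈?_; x∈p∩q⁺; x∈p∩q⁻; p⊆q⇒∣p∣≤∣q∣; ⊆-antisym; ⊆⊤; ∈⊤)
  open import Data.Nat using (suc; _+_; _*_; _≤_; _<_; _≤ᵇ_)
  open import Data.Nat.Properties using (+-comm; m≤n+m; ≤-trans; 1+n≰n; ≤ᵇ⇒≤; ≤⇒≤ᵇ)
  open import Data.Product using (∃; _×_; _,_; proj₁; proj₂)
  open import Data.Sum using (_⊎_; inj₁; inj₂; [_,_]′)
  open import Data.Unit using (tt)
  open import Data.Vec using (lookup)
  open import Data.Vec.Properties using ([]=⇒lookup; lookup⇒[]=)
  open import Data.Vec.Functional using ([]; _∷_; _++_) renaming (foldr to foldrF)
  open import Function.Definitions using (Injective)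
  open import Relation.Binary.PropositionalEquality using (_≡_; _≢_; refl; sym; trans; subst; cong)
  open import Relation.Nullary using (Dec; yes; no; ¬_)
  open import Relation.Nullary.Decidable using (_×-dec_; ¬?)
  open import Function using (_∘_)

  open ProjectivePlane Π public

  Point Line : Set
  Point = Fin (size q)
  Line = Fin (size q)

  infix 4 _on_ _on?_

  _on_ : Point → Line → Set
  P on l = inc P l ≡ true

  _on?_ : ∀ P l → Dec (P on l)
  P on? l = inc P l Bool.≟ true

  on⇒∈pointsOn : ∀ {P l} → P on l → P ∈ pointsOn l
  on⇒∈pointsOn {l = l} = ∈-tabulate⁺ (λ P → inc P l)

  ∈pointsOn⇒on : ∀ {P l} → P ∈ pointsOn l → P on l
  ∈pointsOn⇒on {l = l} = ∈-tabulate⁻ (λ P → inc P l)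

  on⇒∈linesThrough : ∀ {P l} → P on l → l ∈ linesThrough P
  on⇒∈linesThrough {P} = ∈-tabulate⁺ (λ l → inc P l)

  ∈linesThrough⇒on : ∀ {P l} → l ∈ linesThrough P → P on l
  ∈linesThrough⇒on {P} = ∈-tabulate⁻ (λ l → inc P l)

  line-unique : ∀ {P Q l m} → P ≢ Q → P on l → Q on l → P on m → Q on m → l ≡ m
  line-unique {P} {Q} {l} {m} P≢Q Pl Ql Pm Qm with pointsJoin P Q P≢Q
  ... | _ , _ , unique = trans (unique l Pl Ql) (sym (unique m Pm Qm))

  point-unique : ∀ {P Q l m} → l ≢ m → P on l → P on m → Q on l → Q on m → P ≡ Q
  point-unique {P} {Q} {l} {m} l≢m Pl Pm Ql Qm with linesMeet l m l≢m
  ... | _ , _ , unique = trans (unique P Pl Pm) (sym (unique Q Ql Qm))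

  somePoint : Point
  somePoint = fromℕ< (m≤n+m 1 (q * q + q))

  someLine : Line
  someLine = somePoint

  -- The values for equal arguments are junk; only join-on and meet-on are used.
  abstract
    join : Point → Point → Line
    join P Q with P ≟ Q
    ... | yes _   = P
    ... | no P≢Q = proj₁ (pointsJoin P Q P≢Q)

    join-on : ∀ {P Q} → P ≢ Q → P on join P Q × Q on join P Q
    join-on {P} {Q} P≢Q with P ≟ Q
    ... | yes P≡Q = ⊥-elim (P≢Q P≡Q)
    ... | no P≢Q′ = proj₁ (proj₂ (pointsJoin P Q P≢Q′))

    meet : Line → Line → Point
    meet l m with l ≟ m
    ... | yes _   = l
    ... | no l≢m = proj₁ (linesMeet l m l≢m)

    meet-on : ∀ {l m} → l ≢ m → meet l m on l × meet l m on m
    meet-on {l} {m} l≢m with l ≟ m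
    ... | yes l≡m = ⊥-elim (l≢m l≡m)
    ... | no l≢m′ = proj₁ (proj₂ (linesMeet l m l≢m′))

  module _ {P Q : Point} (P≢Q : P ≢ Q) where

    join-onˡ : P on join P Q
    join-onˡ = proj₁ (join-on P≢Q)

    join-onʳ : Q on join P Q
    join-onʳ = proj₂ (join-on P≢Q)

    join-unique : ∀ {l} → P on l → Q on l → l ≡ join P Q
    join-unique Pl Ql = line-unique P≢Q Pl Ql join-onˡ join-onʳ

    not-on-if-≢-join : ∀ {l} → P on l → l ≢ join P Q → ¬ Q on l
    not-on-if-≢-join Pl l≢ Ql = l≢ (join-unique Pl Ql)

  module _ {l m : Line} (l≢m : l ≢ m) where

    meet-onˡ : meet l m on l
    meet-onˡ = proj₁ (meet-on l≢m)

    meet-onʳ : meet l m on m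
    meet-onʳ = proj₂ (meet-on l≢m)

    meet-unique : ∀ {P} → P on l → P on m → P ≡ meet l m
    meet-unique Pl Pm = point-unique l≢m Pl Pm meet-onˡ meet-onʳ

    meet≢-if-not-on : ∀ {P} → ¬ P on m → meet l m ≢ P
    meet≢-if-not-on ¬Pm refl = ¬Pm meet-onʳ

  ≢-by-point : ∀ {P l m} → P on l → ¬ P on m → l ≢ m
  ≢-by-point Pl ¬Pm refl = ¬Pm Pl

  ≢-by-line : ∀ {P Q l} → P on l → ¬ Q on l → P ≢ Q
  ≢-by-line Pl ¬Ql refl = ¬Ql Pl

  record PointsOn (k : ℕ) (l : Line) {j} (avoid : Fin j → Point) : Set where
    field
      point     : Fin k → Point
      injective : Injective _≡_ _≡_ point
      on-line   : ∀ i → point i on l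
      avoids    : ∀ i i′ → avoid i′ ≢ point i

  record LinesThrough (k : ℕ) (P : Point) {j} (avoid : Fin j → Line) : Set where
    field
      line      : Fin k → Line
      injective : Injective _≡_ _≡_ line
      through   : ∀ i → P on line i
      avoids    : ∀ i i′ → avoid i′ ≢ line i

  record PointOn (l : Line) {j} (avoid : Fin j → Point) : Set where
    field
      point   : Point
      on-line : point on l
      avoids  : ∀ i → avoid i ≢ point

  record LineThrough (P : Point) {j} (avoid : Fin j → Line) : Set where
    field
      line    : Line
      through : P on line
      avoids  : ∀ i → avoid i ≢ line

  choosePointsOn : ∀ {j} k l (avoid : Fin j → Point) → j + k ≤ suc q → PointsOn k l avoid
  choosePointsOn k l avoid j+k≤ with choose k (pointsOn l) avoid (subst (_ ≤_) (sym (lineSize l)) j+k≤)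
  ... | f , f-inj , f∈ , f∉ =
    record { point = f ; injective = f-inj ; on-line = ∈pointsOn⇒on ∘ f∈ ; avoids = f∉ }

  chooseLinesThrough : ∀ {j} k P (avoid : Fin j → Line) → j + k ≤ suc q → LinesThrough k P avoid
  chooseLinesThrough k P avoid j+k≤ with choose k (linesThrough P) avoid (subst (_ ≤_) (sym (pointDeg P)) j+k≤)
  ... | f , f-inj , f∈ , f∉ =
    record { line = f ; injective = f-inj ; through = ∈linesThrough⇒on ∘ f∈ ; avoids = f∉ }

  pointOn : ∀ {j} l (avoid : Fin j → Point) → j < suc q → PointOn l avoid
  pointOn l avoid j<1+q = record { point = point zero ; on-line = on-line zero ; avoids = avoids zero }
    where open PointsOn (choosePointsOn 1 l avoid (subst (_≤ suc q) (sym (+-comm _ 1)) j<1+q))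

  lineThrough : ∀ {j} P (avoid : Fin j → Line) → j < suc q → LineThrough P avoid
  lineThrough P avoid j<1+q = record { line = line zero ; through = through zero ; avoids = avoids zero }
    where open LinesThrough (chooseLinesThrough 1 P avoid (subst (_≤ suc q) (sym (+-comm _ 1)) j<1+q))

  count : Line → Subset (size q) → ℕ
  count l S = ∣ pointsOn l ∩ S ∣

  count-mono : ∀ l {S T} → S ⊆ T → count l S ≤ count l T
  count-mono l S⊆T = p⊆q⇒∣p∣≤∣q∣ λ x∈ →
    let x∈l , x∈S = x∈p∩q⁻ (pointsOn l) _ x∈ in x∈p∩q⁺ (x∈l , S⊆T x∈S)

  count≤-if-covered : ∀ {k} l S (g : Fin k → Point) →
                      (∀ {x} → x on l → x ∈ S → ∃ λ i → g i ≡ x) → count l S ≤ k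
  count≤-if-covered l S g cover = covered⇒∣p∣≤ (pointsOn l ∩ S) g λ x∈ →
    let x∈l , x∈S = x∈p∩q⁻ (pointsOn l) S x∈ in cover (∈pointsOn⇒on x∈l) x∈S

  ≤count-if-injective : ∀ {k} l S (f : Fin k → Point) → Injective _≡_ _≡_ f →
                        (∀ i → f i on l) → (∀ i → f i ∈ S) → k ≤ count l S
  ≤count-if-injective l S f f-inj f-on f∈ =
    injective⇒≤∣p∣ (pointsOn l ∩ S) f f-inj (λ i → x∈p∩q⁺ (on⇒∈pointsOn (f-on i) , f∈ i))

  count≤-if-covered-by-lines : ∀ {j k} m S (p : Fin j → Point) (ℓ : Fin k → Line) →
                               (∀ i → m ≢ ℓ i) →
                               (∀ {y} → y on m → y ∈ S → (∃ λ i → p i ≡ y) ⊎ (∃ λ i → y on ℓ i)) →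
                               count m S ≤ j + k
  count≤-if-covered-by-lines {j} m S p ℓ m≢ℓ classify = count≤-if-covered m S (p ++ meet m ∘ ℓ) cover
    where
    cover : ∀ {y} → y on m → y ∈ S → ∃ λ i → (p ++ meet m ∘ ℓ) i ≡ y
    cover y-on y∈S with classify y-on y∈S
    ... | inj₁ (i , pi≡y) = i ↑ˡ _ , trans (cong [ p , meet m ∘ ℓ ]′ (splitAt-↑ˡ j i _)) pi≡y
    ... | inj₂ (i , y-onℓ) = j ↑ʳ i ,
      trans (cong [ p , meet m ∘ ℓ ]′ (splitAt-↑ʳ j _ i)) (sym (meet-unique (m≢ℓ i) y-on y-onℓ))

  count≤-if-covered-but-one : ∀ {k} m S (ℓ : Fin k → Line) → (∀ i → m ≢ ℓ i) →
                              (∀ {x y} → x on m → x ∈ S → (∀ i → ¬ x on ℓ i) →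
                                         y on m → y ∈ S → (∀ i → ¬ y on ℓ i) → x ≡ y) →
                              count m S ≤ suc k
  count≤-if-covered-but-one m S ℓ m≢ℓ unique
    with any? (λ x → x on? m ×-dec x ∈? S ×-dec all? (λ i → ¬? (x on? ℓ i)))
  ... | yes (x , x-on , x∈S , x∉ℓ) = count≤-if-covered-by-lines m S (x ∷ []) ℓ m≢ℓ classify
    where
    classify : ∀ {y} → y on m → y ∈ S → (∃ λ i → (x ∷ []) i ≡ y) ⊎ (∃ λ i → y on ℓ i)
    classify {y} y-on y∈S with any? (λ i → y on? ℓ i)
    ... | yes hit = inj₂ hit
    ... | no miss = inj₁ (zero , unique x-on x∈S x∉ℓ y-on y∈S λ i y-onℓ → miss (i , y-onℓ))
  ... | no none = count≤-if-covered-by-lines m S (m ∷ []) ℓ m≢ℓ classify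
    where
    classify : ∀ {y} → y on m → y ∈ S → (∃ λ i → (m ∷ []) i ≡ y) ⊎ (∃ λ i → y on ℓ i)
    classify {y} y-on y∈S with any? (λ i → y on? ℓ i)
    ... | yes hit = inj₂ hit
    ... | no miss = ⊥-elim (none (y , y-on , y∈S , λ i y-onℓ → miss (i , y-onℓ)))

  meets-injective : ∀ {k} m (ℓ : Fin k → Line) → (∀ i → m ≢ ℓ i) →
                    (∀ {y i i′} → i ≢ i′ → y on m → y on ℓ i → y on ℓ i′ → ⊥) →
                    Injective _≡_ _≡_ (meet m ∘ ℓ)
  meets-injective m ℓ m≢ℓ no-vertex {i} {i′} eq with i ≟ i′
  ... | yes i≡i′ = i≡i′
  ... | no i≢i′ = ⊥-elim (no-vertex i≢i′ (meet-onˡ (m≢ℓ i)) (meet-onʳ (m≢ℓ i))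
                            (subst (_on ℓ i′) (sym eq) (meet-onʳ (m≢ℓ i′))))

  module Percolating (r : ℕ) where

    open Percolation Π r public

    private
      ∨-true⁻ : ∀ {a b} → (a ∨ b) ≡ true → a ≡ true ⊎ b ≡ true
      ∨-true⁻ {true}  _ = inj₁ refl
      ∨-true⁻ {false} e = inj₂ e

      ∧-true⁻ : ∀ {a b} → (a ∧ b) ≡ true → a ≡ true × b ≡ true
      ∧-true⁻ {true} e = refl , e

      ∨-trueʳ : ∀ a → (a ∨ true) ≡ true
      ∨-trueʳ true  = refl
      ∨-trueʳ false = refl

      foldr-∨⁻ : ∀ {n} (t : Line → Bool) (ls : Fin n → Line) →
                 foldrF (λ l b → t l ∨ b) false ls ≡ true → ∃ λ i → t (ls i) ≡ true
      foldr-∨⁻ {suc n} t ls e with ∨-true⁻ {t (ls zero)} e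
      ... | inj₁ e₀ = zero , e₀
      ... | inj₂ e′ with foldr-∨⁻ t (λ i → ls (suc i)) e′
      ...   | i , eᵢ = suc i , eᵢ

      foldr-∨⁺ : ∀ {n} (t : Line → Bool) (ls : Fin n → Line) i →
                 t (ls i) ≡ true → foldrF (λ l b → t l ∨ b) false ls ≡ true
      foldr-∨⁺ t ls zero e rewrite e = refl
      foldr-∨⁺ t ls (suc i) e with t (ls zero)
      ... | true  = refl
      ... | false = foldr-∨⁺ t (λ i → ls (suc i)) i e

      activation : Subset (size q) → Point → Line → Bool
      activation A P l = inc P l ∧ (r ≤ᵇ count l A)

    activated⁻ : ∀ A P → activated A P ≡ true → ∃ λ l → P on l × r ≤ count l A
    activated⁻ A P e with foldr-∨⁻ (activation A P) (λ l → l) e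
    ... | l , e′ with ∧-true⁻ {inc P l} e′
    ...   | P-on , r≤ = l , P-on , ≤ᵇ⇒≤ r _ (subst T (sym r≤) tt)

    activated⁺ : ∀ A {P} l → P on l → r ≤ count l A → activated A P ≡ true
    activated⁺ A {P} l P-on r≤ = foldr-∨⁺ (activation A P) (λ l → l) l
      (subst (λ b → (b ∧ (r ≤ᵇ count l A)) ≡ true) (sym P-on) (T⇒≡ (≤⇒≤ᵇ r≤)))
      where
      T⇒≡ : ∀ {b} → T b → b ≡ true
      T⇒≡ {true} _ = refl

    ∈-step⁻ : ∀ A {P} → P ∈ step A → P ∈ A ⊎ ∃ λ l → P on l × r ≤ count l A
    ∈-step⁻ A {P} P∈ with ∨-true⁻ {lookup A P} (∈-tabulate⁻ (λ P → lookup A P ∨ activated A P) P∈)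
    ... | inj₁ e = inj₁ (lookup⇒[]= P A e)
    ... | inj₂ e = inj₂ (activated⁻ A P e)

    ⊆-step : ∀ A → A ⊆ step A
    ⊆-step A {P} P∈A = ∈-tabulate⁺ (λ P → lookup A P ∨ activated A P)
      (subst (λ b → (b ∨ activated A P) ≡ true) (sym ([]=⇒lookup P∈A)) refl)

    ∈-step⁺ : ∀ A {P} l → P on l → r ≤ count l A → P ∈ step A
    ∈-step⁺ A {P} l P-on r≤ = ∈-tabulate⁺ (λ P → lookup A P ∨ activated A P)
      (subst (λ b → (lookup A P ∨ b) ≡ true) (sym (activated⁺ A l P-on r≤)) (∨-trueʳ (lookup A P)))

    Closed : Subset (size q) → Set
    Closed C = ∀ l → r ≤ count l C → ∀ {P} → P on l → P ∈ C

    closed-if-full-or-sparse : ∀ C → (∀ l → (∀ {P} → P on l → P ∈ C) ⊎ count l C < r) → Closed C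
    closed-if-full-or-sparse C full-or-sparse l r≤ P-on with full-or-sparse l
    ... | inj₁ full   = full P-on
    ... | inj₂ sparse = ⊥-elim (1+n≰n (≤-trans sparse r≤))

    iter-⊆-closed : ∀ {B C} → Closed C → B ⊆ C → ∀ k → iter k B ⊆ C
    iter-⊆-closed closed B⊆C ℕ.zero = B⊆C
    iter-⊆-closed {B} closed B⊆C (ℕ.suc k) P∈ with ∈-step⁻ (iter k B) P∈
    ... | inj₁ P∈iter         = iter-⊆-closed closed B⊆C k P∈iter
    ... | inj₂ (l , P-on , r≤) =
      closed l (≤-trans r≤ (count-mono l (iter-⊆-closed closed B⊆C k))) P-on

    -- A witness that x cannot be dropped from A: whatever percolates from A - x stays inside set.
    record Blocker (A : Subset (size q)) (x : Point) : Set where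
      field
        set      : Subset (size q)
        closed   : Closed set
        ⊇A-x     : ∀ {y} → y ∈ A → y ≢ x → y ∈ set
        outside  : Point
        outside∉ : outside ∉ set

    ∈-step-if-transversal : ∀ S (ℓ : Fin r → Line) m → (∀ i → m ≢ ℓ i) →
                            (∀ {y i i′} → i ≢ i′ → y on m → y on ℓ i → y on ℓ i′ → ⊥) →
                            (∀ i {y} → y on ℓ i → y ∈ S) → ∀ {P} → P on m → P ∈ step S
    ∈-step-if-transversal S ℓ m m≢ℓ no-vertex ℓ⊆S P-on =
      ∈-step⁺ S m P-on (≤count-if-injective m S (meet m ∘ ℓ) (meets-injective m ℓ m≢ℓ no-vertex)
                          (λ i → meet-onˡ (m≢ℓ i)) (λ i → ℓ⊆S i (meet-onʳ (m≢ℓ i))))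

    minimal-if-blocked : ∀ A → Percolates A → (∀ {x} → x ∈ A → Blocker A x) → MinimalPercolating A
    minimal-if-blocked A percolates blocker = percolates , not-percolates
      where
      not-percolates : ∀ B → B ⊂ A → ¬ Percolates B
      not-percolates B (B⊆A , x , x∈A , x∉B) (k , iter≡⊤) =
        outside∉ (iter-⊆-closed closed B⊆set k (subst (outside ∈_) (sym iter≡⊤) ∈⊤))
        where
        open Blocker (blocker x∈A)
        B⊆set : B ⊆ set
        B⊆set y∈B = ⊇A-x (B⊆A y∈B) λ { refl → x∉B y∈B }

    minimal-with-time-three : ∀ A x → x ∉ iter 2 A → (∀ P → P ∈ iter 3 A) →
                              (∀ {x} → x ∈ A → Blocker A x) →
                              MinimalPercolating A × iter 2 A ≢ ⊤ × iter 3 A ≡ ⊤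
    minimal-with-time-three A x x∉ all∈ blocker =
      minimal-if-blocked A (3 , iter≡⊤) blocker , (λ e → x∉ (subst (x ∈_) (sym e) ∈⊤)) , iter≡⊤
      where
      iter≡⊤ : iter 3 A ≡ ⊤
      iter≡⊤ = ⊆-antisym ⊆⊤ λ {P} _ → all∈ P

module Pencil {q : ℕ} (Π : ProjectivePlane q) where

  open Counting
  open Geometry Π
  open import Data.Empty using (⊥; ⊥-elim)
  open import Data.Fin using (Fin; zero; suc; _≟_; punchIn; punchOut; combine; remQuot)
  open import Data.Fin.Properties using (any?; punchInᵢ≢i; punchIn-punchOut; remQuot-combine)
  open import Data.Fin.Subset using (Subset; _∈_; _∉_; _⊆_; ⊤)
  open import Data.Nat using (suc; _+_; _*_; _≤_; _<_; z≤n; s≤s)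
  open import Data.Nat.Properties using (≤-trans; ≤-<-trans; <⇒≱; m≤m+n; n≤1+n)
  open import Data.Product using (Σ; ∃; ∃₂; _×_; _,_; proj₁; proj₂; uncurry)
  open import Data.Sum using (_⊎_; inj₁; inj₂)
  open import Data.Vec.Functional using ([]; _∷_; _++_)
  open import Function using (_∘_)
  open import Data.Nat.Tactic.RingSolver using (solve-∀)
  open import Function.Definitions using (Injective)
  open import Relation.Binary.PropositionalEquality using (_≡_; _≢_; refl; sym; trans; subst; cong)
  open import Relation.Nullary using (yes; no; ¬_)
  open import Relation.Nullary.Decidable using (_⊎-dec_; _×-dec_; ¬?)
  open import Relation.Unary using (Decidable)

  record Configuration (n : ℕ) : Set where
    field
      O Y x       : Point
      W           : Line
      K           : Fin 2 → Line
      L           : Fin n → Line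
      P           : Fin n → Fin (suc n) → Point
      O≢Y         : O ≢ Y
      O-on-W      : O on W
      Y-not-on-W  : ¬ Y on W
      L-injective : Injective _≡_ _≡_ L
      O-on-L      : ∀ j → O on L j
      Y-not-on-L  : ∀ j → ¬ Y on L j
      L≢W         : ∀ j → L j ≢ W
      K-injective : Injective _≡_ _≡_ K
      Y-on-K      : ∀ i → Y on K i
      O-not-on-K  : ∀ i → ¬ O on K i
      P-injective : ∀ j → Injective _≡_ _≡_ (P j)
      P-on-L      : ∀ j k → P j k on L j
      P≢O         : ∀ j k → P j k ≢ O
      P-not-on-K  : ∀ i j k → ¬ P j k on K i
      x-on-OY     : x on join O Y
      x≢O         : x ≢ O
      x≢Y         : x ≢ Y

  fin2-≢⇒≡ : ∀ {i j k : Fin 2} → j ≢ i → k ≢ i → j ≡ k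
  fin2-≢⇒≡ {zero}     {zero}                 j≢i _   = ⊥-elim (j≢i refl)
  fin2-≢⇒≡ {zero}     {suc zero} {zero}      _   k≢i = ⊥-elim (k≢i refl)
  fin2-≢⇒≡ {zero}     {suc zero} {suc zero}  _   _   = refl
  fin2-≢⇒≡ {suc zero} {suc zero}             j≢i _   = ⊥-elim (j≢i refl)
  fin2-≢⇒≡ {suc zero} {zero}     {suc zero}  _   k≢i = ⊥-elim (k≢i refl)
  fin2-≢⇒≡ {suc zero} {zero}     {zero}      _   _   = refl

  module TimeThree (s : ℕ) (cfg : Configuration (2 + s)) where

    open Configuration cfg

    n r : ℕ
    n = 2 + s
    r = 2 + n

    open Percolating r

    V : Line
    V = join O Y

    a : Fin 2 → Point
    a i = meet (K i) W

    K≢W : ∀ i → K i ≢ W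
    K≢W i = ≢-by-point O-on-W (O-not-on-K i) ∘ sym

    K≢L : ∀ i j → K i ≢ L j
    K≢L i j = ≢-by-point (Y-on-K i) (Y-not-on-L j)

    V≢W : V ≢ W
    V≢W = ≢-by-point (join-onʳ O≢Y) Y-not-on-W

    V≢L : ∀ j → V ≢ L j
    V≢L j = ≢-by-point (join-onʳ O≢Y) (Y-not-on-L j)

    a-on-K : ∀ i → a i on K i
    a-on-K i = meet-onˡ (K≢W i)

    a-on-W : ∀ i → a i on W
    a-on-W i = meet-onʳ (K≢W i)

    a≢O : ∀ i → a i ≢ O
    a≢O i = ≢-by-line (a-on-K i) (O-not-on-K i)

    a≢Y : ∀ i → a i ≢ Y
    a≢Y i = ≢-by-line (a-on-W i) Y-not-on-W

    L-vertex : ∀ {y j j′} → j ≢ j′ → y on L j → y on L j′ → y ≡ O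
    L-vertex j≢j′ y-on y-on′ = point-unique (j≢j′ ∘ L-injective) y-on y-on′ (O-on-L _) (O-on-L _)

    K-vertex : ∀ {y i i′} → i ≢ i′ → y on K i → y on K i′ → y ≡ Y
    K-vertex i≢i′ y-on y-on′ = point-unique (i≢i′ ∘ K-injective) y-on y-on′ (Y-on-K _) (Y-on-K _)

    a-not-on-L : ∀ i j → ¬ a i on L j
    a-not-on-L i j a-on = a≢O i (point-unique (L≢W j) a-on (a-on-W i) (O-on-L j) O-on-W)

    a-not-on-K : ∀ {i i′} → i ≢ i′ → ¬ a i on K i′
    a-not-on-K i≢i′ a-on = a≢Y _ (K-vertex i≢i′ (a-on-K _) a-on)

    a-injective : ∀ {i i′} → i ≢ i′ → a i ≢ a i′
    a-injective i≢i′ eq = a-not-on-K i≢i′ (subst (_on K _) (sym eq) (a-on-K _))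

    InA : Point → Set
    InA y = y ≡ O ⊎ y ≡ Y ⊎ (∃ λ i → y ≡ a i) ⊎ (∃₂ λ j k → y ≡ P j k)

    InA? : Decidable InA
    InA? y = y ≟ O ⊎-dec y ≟ Y ⊎-dec any? (λ i → y ≟ a i)
                     ⊎-dec any? (λ j → any? (λ k → y ≟ P j k))

    A : Subset (size q)
    A = subset InA?

    A₁ A₂ : Subset (size q)
    A₁ = step A
    A₂ = step A₁

    O∈A : O ∈ A
    O∈A = ∈-subset⁺ InA? (inj₁ refl)

    Y∈A : Y ∈ A
    Y∈A = ∈-subset⁺ InA? (inj₂ (inj₁ refl))

    a∈A : ∀ i → a i ∈ A
    a∈A i = ∈-subset⁺ InA? (inj₂ (inj₂ (inj₁ (i , refl))))

    P∈A : ∀ j k → P j k ∈ A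
    P∈A j k = ∈-subset⁺ InA? (inj₂ (inj₂ (inj₂ (j , k , refl))))

    A-on-L : ∀ {y j} → InA y → y on L j → y ≡ O ⊎ ∃ λ k → y ≡ P j k
    A-on-L (inj₁ y≡O) _ = inj₁ y≡O
    A-on-L (inj₂ (inj₁ refl)) Y-on = ⊥-elim (Y-not-on-L _ Y-on)
    A-on-L (inj₂ (inj₂ (inj₁ (i , refl)))) a-on = ⊥-elim (a-not-on-L i _ a-on)
    A-on-L {j = j} (inj₂ (inj₂ (inj₂ (j′ , k , refl)))) P-on with j′ ≟ j
    ... | yes refl = inj₂ (k , refl)
    ... | no j′≢j  = ⊥-elim (P≢O j′ k (L-vertex j′≢j (P-on-L j′ k) P-on))

    A-on-K : ∀ {y i} → InA y → y on K i → y ≡ Y ⊎ y ≡ a i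
    A-on-K (inj₁ refl) O-on = ⊥-elim (O-not-on-K _ O-on)
    A-on-K (inj₂ (inj₁ y≡Y)) _ = inj₁ y≡Y
    A-on-K {i = i} (inj₂ (inj₂ (inj₁ (i′ , refl)))) a-on with i′ ≟ i
    ... | yes refl = inj₂ refl
    ... | no i′≢i  = ⊥-elim (a-not-on-K i′≢i a-on)
    A-on-K (inj₂ (inj₂ (inj₂ (j , k , refl)))) P-on = ⊥-elim (P-not-on-K _ j k P-on)

    Stage₁ : Point → Set
    Stage₁ y = (∃ λ j → y on L j) ⊎ y ≡ Y ⊎ (∃ λ i → y ≡ a i)

    A⊆Stage₁ : ∀ {y} → InA y → Stage₁ y
    A⊆Stage₁ (inj₁ refl) = inj₁ (zero , O-on-L zero)
    A⊆Stage₁ (inj₂ (inj₁ y≡Y)) = inj₂ (inj₁ y≡Y)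
    A⊆Stage₁ (inj₂ (inj₂ (inj₁ y≡a))) = inj₂ (inj₂ y≡a)
    A⊆Stage₁ (inj₂ (inj₂ (inj₂ (j , k , refl)))) = inj₁ (j , P-on-L j k)

    3≤1+n : 3 ≤ suc n
    3≤1+n = s≤s (s≤s (s≤s z≤n))

    sparse-through-O : ∀ S → (∀ {y} → y ∈ S → Stage₁ y) → ∀ m → O on m → (∀ j → m ≢ L j) →
                       count m S < r
    sparse-through-O S S⊆ m O-on m≢L with Y on? m
    ... | yes Y-on = s≤s (≤-trans (count≤-if-covered m S (O ∷ λ _ → Y) cover) 3≤1+n)
      where
      cover : ∀ {y} → y on m → y ∈ S → ∃ λ i → (O ∷ λ _ → Y) i ≡ y
      cover y-on y∈S with S⊆ y∈S
      ... | inj₁ (j , y-onL) = zero , sym (point-unique (m≢L j) y-on y-onL O-on (O-on-L j))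
      ... | inj₂ (inj₁ refl) = suc zero , refl
      ... | inj₂ (inj₂ (i , refl)) =
        ⊥-elim (Y-not-on-W (subst (Y on_) (line-unique (a≢O i) y-on O-on (a-on-W i) O-on-W) Y-on))
    ... | no ¬Y-on = s≤s (≤-trans (count≤-if-covered m S (O ∷ a) cover) 3≤1+n)
      where
      cover : ∀ {y} → y on m → y ∈ S → ∃ λ i → (O ∷ a) i ≡ y
      cover y-on y∈S with S⊆ y∈S
      ... | inj₁ (j , y-onL) = zero , sym (point-unique (m≢L j) y-on y-onL O-on (O-on-L j))
      ... | inj₂ (inj₁ refl) = ⊥-elim (¬Y-on y-on)
      ... | inj₂ (inj₂ (i , refl)) = suc i , refl

    -- Off O, a line meets the pencil in n points, and Y, a 0, a 1 are pairwise joined by K 0, K 1 and W.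
    sparse-off-O : ∀ S → (∀ {y} → y ∈ S → Stage₁ y) → ∀ m → ¬ O on m → (∀ j → m ≢ L j) →
                   (∀ i → m ≢ K i) → count m S < r
    sparse-off-O S S⊆ m ¬O-on m≢L m≢K = s≤s (count≤-if-covered-but-one m S L m≢L unique)
      where
      special : ∀ {y} → y ∈ S → (∀ j → ¬ y on L j) → y ≡ Y ⊎ ∃ λ i → y ≡ a i
      special y∈S off with S⊆ y∈S
      ... | inj₁ (j , y-on) = ⊥-elim (off j y-on)
      ... | inj₂ y-special = y-special
      Y≢a : ∀ {i} → Y on m → a i on m → ⊥
      Y≢a {i} Y-on a-on = m≢K i (line-unique (a≢Y i ∘ sym) Y-on a-on (Y-on-K i) (a-on-K i))
      unique : ∀ {x y} → x on m → x ∈ S → (∀ j → ¬ x on L j) →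
                         y on m → y ∈ S → (∀ j → ¬ y on L j) → x ≡ y
      unique x-on x∈ x-off y-on y∈ y-off with special x∈ x-off | special y∈ y-off
      ... | inj₁ refl | inj₁ refl = refl
      ... | inj₁ refl | inj₂ (i , refl) = ⊥-elim (Y≢a x-on y-on)
      ... | inj₂ (i , refl) | inj₁ refl = ⊥-elim (Y≢a y-on x-on)
      ... | inj₂ (i , refl) | inj₂ (i′ , refl) with i ≟ i′
      ...   | yes refl = refl
      ...   | no i≢i′ = ⊥-elim (¬O-on (subst (O on_) (sym m≡W) O-on-W))
        where
        m≡W : m ≡ W
        m≡W = line-unique (a-injective i≢i′) x-on y-on (a-on-W i) (a-on-W i′)

    sparse : ∀ S → (∀ {y} → y ∈ S → Stage₁ y) → ∀ m → (∀ j → m ≢ L j) → (∀ i → m ≢ K i) →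
             count m S < r
    sparse S S⊆ m m≢L m≢K with O on? m
    ... | yes O-on = sparse-through-O S S⊆ m O-on m≢L
    ... | no ¬O-on = sparse-off-O S S⊆ m ¬O-on m≢L m≢K

    L? : ∀ m → (∃ λ j → m ≡ L j) ⊎ (∀ j → m ≢ L j)
    L? m with any? (λ j → m ≟ L j)
    ... | yes m≡L = inj₁ m≡L
    ... | no m≢L  = inj₂ λ j eq → m≢L (j , eq)

    K? : ∀ m → (∃ λ i → m ≡ K i) ⊎ (∀ i → m ≢ K i)
    K? m with any? (λ i → m ≟ K i)
    ... | yes m≡K = inj₁ m≡K
    ... | no m≢K  = inj₂ λ i eq → m≢K (i , eq)

    sparse-A : ∀ m → (∀ j → m ≢ L j) → count m A < r
    sparse-A m m≢L with K? m
    ... | inj₂ m≢K = sparse A (A⊆Stage₁ ∘ ∈-subset⁻ InA?) m m≢L m≢K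
    ... | inj₁ (i , refl) =
      s≤s (≤-trans (count≤-if-covered (K i) A (Y ∷ a i ∷ []) cover) (s≤s (s≤s z≤n)))
      where
      cover : ∀ {y} → y on K i → y ∈ A → ∃ λ t → (Y ∷ a i ∷ []) t ≡ y
      cover y-on y∈A with A-on-K (∈-subset⁻ InA? y∈A) y-on
      ... | inj₁ refl = zero , refl
      ... | inj₂ refl = suc zero , refl

    on-L⇒∈A₁ : ∀ j {y} → y on L j → y ∈ A₁
    on-L⇒∈A₁ j y-on = ∈-step⁺ A (L j) y-on
      (≤count-if-injective (L j) A (O ∷ P j) (∷-injective (P-injective j) (P≢O j)) f-on ∈A)
      where
      f-on : ∀ t → (O ∷ P j) t on L j
      f-on zero    = O-on-L j
      f-on (suc k) = P-on-L j k
      ∈A : ∀ t → (O ∷ P j) t ∈ A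
      ∈A zero    = O∈A
      ∈A (suc k) = P∈A j k

    A₁⊆Stage₁ : ∀ {y} → y ∈ A₁ → Stage₁ y
    A₁⊆Stage₁ y∈A₁ with ∈-step⁻ A y∈A₁
    ... | inj₁ y∈A = A⊆Stage₁ (∈-subset⁻ InA? y∈A)
    ... | inj₂ (m , y-on , r≤) with L? m
    ...   | inj₁ (j , refl) = inj₁ (j , y-on)
    ...   | inj₂ m≢L = ⊥-elim (<⇒≱ (sparse-A m m≢L) r≤)

    on-K⇒∈A₂ : ∀ i {y} → y on K i → y ∈ A₂
    on-K⇒∈A₂ i y-on = ∈-step⁺ A₁ (K i) y-on (≤count-if-injective (K i) A₁ f f-injective f-on ∈A₁)
      where
      f : Fin r → Point
      f = Y ∷ a i ∷ meet (K i) ∘ L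
      meets-injective′ : Injective _≡_ _≡_ (meet (K i) ∘ L)
      meets-injective′ = meets-injective (K i) L (K≢L i) λ j≢j′ z-on z-on-L z-on-L′ →
        O-not-on-K i (subst (_on K i) (L-vertex j≢j′ z-on-L z-on-L′) z-on)
      f-injective : Injective _≡_ _≡_ f
      f-injective = ∷-injective (∷-injective meets-injective′
                      (λ j eq → a-not-on-L i j (subst (_on L j) eq (meet-onʳ (K≢L i j)))))
                      λ { zero → a≢Y i
                        ; (suc j) eq → Y-not-on-L j (subst (_on L j) eq (meet-onʳ (K≢L i j))) }
      f-on : ∀ t → f t on K i
      f-on zero          = Y-on-K i
      f-on (suc zero)    = a-on-K i
      f-on (suc (suc j)) = meet-onˡ (K≢L i j)
      ∈A₁ : ∀ t → f t ∈ A₁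
      ∈A₁ zero          = ⊆-step A Y∈A
      ∈A₁ (suc zero)    = ⊆-step A (a∈A i)
      ∈A₁ (suc (suc j)) = on-L⇒∈A₁ j (meet-onʳ (K≢L i j))

    x-not-on-L : ∀ j → ¬ x on L j
    x-not-on-L j x-on = x≢O (point-unique (V≢L j) x-on-OY x-on (join-onˡ O≢Y) (O-on-L j))

    x∉A₁ : x ∉ A₁
    x∉A₁ x∈ with A₁⊆Stage₁ x∈
    ... | inj₁ (j , x-on) = x-not-on-L j x-on
    ... | inj₂ (inj₁ x≡Y) = x≢Y x≡Y
    ... | inj₂ (inj₂ (i , refl)) =
      a≢O i (point-unique V≢W x-on-OY (a-on-W i) (join-onˡ O≢Y) O-on-W)

    x∉A₂ : x ∉ A₂
    x∉A₂ x∈ with ∈-step⁻ A₁ x∈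
    ... | inj₁ x∈A₁ = x∉A₁ x∈A₁
    ... | inj₂ (m , x-on , r≤) = <⇒≱ (sparse A₁ A₁⊆Stage₁ m m≢L m≢K) r≤
      where
      m≢L : ∀ j → m ≢ L j
      m≢L j = ≢-by-point x-on (x-not-on-L j)
      m≢K : ∀ i → m ≢ K i
      m≢K i refl = O-not-on-K i
        (subst (O on_) (line-unique x≢Y x-on-OY (join-onʳ O≢Y) x-on (Y-on-K i)) (join-onˡ O≢Y))

    module _ (lines-fit : 3 + 2 * n ≤ suc q) {y : Point}
             (y-off-L : ∀ j → ¬ y on L j) (y-off-K : ∀ i → ¬ y on K i) where

      private
        vertex : Fin (2 * n) → Point
        vertex = uncurry (λ i j → meet (K i) (L j)) ∘ remQuot n

        avoided : Fin (2 + 2 * n) → Line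
        avoided = join y O ∷ join y Y ∷ join y ∘ vertex

        m-choice : LineThrough y avoided
        m-choice = lineThrough y avoided lines-fit

        m : Line
        m = LineThrough.line m-choice

        y-on-m : y on m
        y-on-m = LineThrough.through m-choice

        m-avoids : ∀ t → avoided t ≢ m
        m-avoids = LineThrough.avoids m-choice

        y≢O : y ≢ O
        y≢O = ≢-by-line (O-on-L zero) (y-off-L zero) ∘ sym

        y≢Y : y ≢ Y
        y≢Y = ≢-by-line (Y-on-K zero) (y-off-K zero) ∘ sym

        O-not-on-m : ¬ O on m
        O-not-on-m = not-on-if-≢-join y≢O y-on-m (m-avoids zero ∘ sym)

        Y-not-on-m : ¬ Y on m
        Y-not-on-m = not-on-if-≢-join y≢Y y-on-m (m-avoids (suc zero) ∘ sym)

        KL-not-on-m : ∀ {z} i j → z on K i → z on L j → ¬ z on m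
        KL-not-on-m {z} i j z-on-K z-on-L z-on-m =
          m-avoids (suc (suc (combine i j))) (sym (join-unique y≢v y-on-m v-on-m))
          where
          z≡v : z ≡ vertex (combine i j)
          z≡v = trans (meet-unique (K≢L i j) z-on-K z-on-L)
                      (sym (cong (uncurry (λ i j → meet (K i) (L j))) (remQuot-combine i j)))
          v-on-m : vertex (combine i j) on m
          v-on-m = subst (_on m) z≡v z-on-m
          y≢v : y ≢ vertex (combine i j)
          y≢v y≡v = y-off-K i (subst (_on K i) (trans z≡v (sym y≡v)) z-on-K)

        ℓ : Fin r → Line
        ℓ = K ++ L

        no-vertex : ∀ {z t t′} → t ≢ t′ → z on m → z on ℓ t → z on ℓ t′ → ⊥
        no-vertex {t = zero}          {zero}           t≢t′ _ _ _ = t≢t′ refl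
        no-vertex {t = suc zero}      {suc zero}       t≢t′ _ _ _ = t≢t′ refl
        no-vertex {t = zero}          {suc zero}       _ z-on z-K z-K′ =
          Y-not-on-m (subst (_on m) (K-vertex (λ ()) z-K z-K′) z-on)
        no-vertex {t = suc zero}      {zero}           _ z-on z-K z-K′ =
          Y-not-on-m (subst (_on m) (K-vertex (λ ()) z-K z-K′) z-on)
        no-vertex {t = zero}          {suc (suc j)}    _ z-on z-K z-L = KL-not-on-m zero j z-K z-L z-on
        no-vertex {t = suc zero}      {suc (suc j)}    _ z-on z-K z-L = KL-not-on-m (suc zero) j z-K z-L z-on
        no-vertex {t = suc (suc j)}   {zero}           _ z-on z-L z-K = KL-not-on-m zero j z-K z-L z-on
        no-vertex {t = suc (suc j)}   {suc zero}       _ z-on z-L z-K = KL-not-on-m (suc zero) j z-K z-L z-on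
        no-vertex {t = suc (suc j)}   {suc (suc j′)}   t≢t′ z-on z-L z-L′ =
          O-not-on-m (subst (_on m) (L-vertex (λ { refl → t≢t′ refl }) z-L z-L′) z-on)

        m≢ℓ : ∀ t → m ≢ ℓ t
        m≢ℓ zero          = ≢-by-point y-on-m (y-off-K zero)
        m≢ℓ (suc zero)    = ≢-by-point y-on-m (y-off-K (suc zero))
        m≢ℓ (suc (suc j)) = ≢-by-point y-on-m (y-off-L j)

        ℓ⊆A₂ : ∀ t {z} → z on ℓ t → z ∈ A₂
        ℓ⊆A₂ zero          = on-K⇒∈A₂ zero
        ℓ⊆A₂ (suc zero)    = on-K⇒∈A₂ (suc zero)
        ℓ⊆A₂ (suc (suc j)) = ⊆-step A₁ ∘ on-L⇒∈A₁ j

      off-arrangement⇒∈A₃ : y ∈ step A₂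
      off-arrangement⇒∈A₃ = ∈-step-if-transversal A₂ ℓ m m≢ℓ no-vertex ℓ⊆A₂ y-on-m

    ∈A₃ : 3 + 2 * n ≤ suc q → ∀ y → y ∈ step A₂
    ∈A₃ lines-fit y with any? (λ j → y on? L j) | any? (λ i → y on? K i)
    ... | yes (j , y-on) | _ = ⊆-step A₂ (⊆-step A₁ (on-L⇒∈A₁ j y-on))
    ... | no _ | yes (i , y-on) = ⊆-step A₂ (on-K⇒∈A₂ i y-on)
    ... | no off-L | no off-K =
      off-arrangement⇒∈A₃ lines-fit (λ j y-on → off-L (j , y-on)) (λ i y-on → off-K (i , y-on))

    blocker-O : Blocker A O
    blocker-O = record
      { set = C ; closed = closed-if-full-or-sparse C full-or-sparse
      ; ⊇A-x = λ y∈A y≢O → ∈-subset⁺ C? (∈-subset⁻ InA? y∈A , y≢O)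
      ; outside = O ; outside∉ = λ O∈C → proj₂ (∈-subset⁻ C? O∈C) refl }
      where
      C? : Decidable (λ y → InA y × y ≢ O)
      C? y = InA? y ×-dec ¬? (y ≟ O)
      C : Subset (size q)
      C = subset C?
      C⊆A : C ⊆ A
      C⊆A y∈C = ∈-subset⁺ InA? (proj₁ (∈-subset⁻ C? y∈C))
      full-or-sparse : ∀ m → (∀ {y} → y on m → y ∈ C) ⊎ count m C < r
      full-or-sparse m with L? m
      ... | inj₂ m≢L = inj₂ (≤-<-trans (count-mono m C⊆A) (sparse-A m m≢L))
      ... | inj₁ (j , refl) = inj₂ (s≤s (count≤-if-covered (L j) C (P j) cover))
        where
        cover : ∀ {y} → y on L j → y ∈ C → ∃ λ k → P j k ≡ y
        cover y-on y∈C with ∈-subset⁻ C? y∈C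
        ... | y∈A , y≢O with A-on-L y∈A y-on
        ...   | inj₁ y≡O = ⊥-elim (y≢O y≡O)
        ...   | inj₂ (k , refl) = k , refl

    blocker-Y : Blocker A Y
    blocker-Y = record
      { set = C ; closed = closed-if-full-or-sparse C full-or-sparse
      ; ⊇A-x = ⊇A-Y ; outside = Y ; outside∉ = Y∉C }
      where
      C? : Decidable (λ y → (∃ λ j → y on L j) ⊎ ∃ λ i → y ≡ a i)
      C? y = any? (λ j → y on? L j) ⊎-dec any? (λ i → y ≟ a i)
      C : Subset (size q)
      C = subset C?
      C⊆Stage₁ : ∀ {y} → y ∈ C → Stage₁ y
      C⊆Stage₁ y∈C with ∈-subset⁻ C? y∈C
      ... | inj₁ on-L = inj₁ on-L
      ... | inj₂ y≡a  = inj₂ (inj₂ y≡a)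
      full-or-sparse : ∀ m → (∀ {y} → y on m → y ∈ C) ⊎ count m C < r
      full-or-sparse m with L? m | K? m
      ... | inj₁ (j , refl) | _ = inj₁ λ y-on → ∈-subset⁺ C? (inj₁ (j , y-on))
      ... | inj₂ m≢L | inj₂ m≢K = inj₂ (sparse C C⊆Stage₁ m m≢L m≢K)
      ... | inj₂ _ | inj₁ (i , refl) =
        inj₂ (s≤s (count≤-if-covered-by-lines (K i) C (a i ∷ []) L (K≢L i) classify))
        where
        classify : ∀ {y} → y on K i → y ∈ C → (∃ λ t → (a i ∷ []) t ≡ y) ⊎ (∃ λ j → y on L j)
        classify y-on y∈C with ∈-subset⁻ C? y∈C
        ... | inj₁ on-L = inj₂ on-L
        ... | inj₂ (i′ , refl) with i′ ≟ i
        ...   | yes refl = inj₁ (zero , refl)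
        ...   | no i′≢i  = ⊥-elim (a-not-on-K i′≢i y-on)
      ⊇A-Y : ∀ {y} → y ∈ A → y ≢ Y → y ∈ C
      ⊇A-Y y∈A y≢Y with ∈-subset⁻ InA? y∈A
      ... | inj₁ refl = ∈-subset⁺ C? (inj₁ (zero , O-on-L zero))
      ... | inj₂ (inj₁ refl) = ⊥-elim (y≢Y refl)
      ... | inj₂ (inj₂ (inj₁ y≡a)) = ∈-subset⁺ C? (inj₂ y≡a)
      ... | inj₂ (inj₂ (inj₂ (j , k , refl))) = ∈-subset⁺ C? (inj₁ (j , P-on-L j k))
      Y∉C : Y ∉ C
      Y∉C Y∈C with ∈-subset⁻ C? Y∈C
      ... | inj₁ (j , Y-on) = Y-not-on-L j Y-on
      ... | inj₂ (i , Y≡a)  = a≢Y i (sym Y≡a)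

    blocker-a : ∀ {i i′} → i ≢ i′ → Blocker A (a i)
    blocker-a {i} {i′} i≢i′ = record
      { set = C ; closed = closed-if-full-or-sparse C full-or-sparse
      ; ⊇A-x = ⊇A-a ; outside = a i ; outside∉ = a∉C }
      where
      C? : Decidable (λ y → (∃ λ j → y on L j) ⊎ y on K i′)
      C? y = any? (λ j → y on? L j) ⊎-dec y on? K i′
      C : Subset (size q)
      C = subset C?
      full-or-sparse : ∀ m → (∀ {y} → y on m → y ∈ C) ⊎ count m C < r
      full-or-sparse m with L? m | m ≟ K i′
      ... | inj₁ (j , refl) | _ = inj₁ λ y-on → ∈-subset⁺ C? (inj₁ (j , y-on))
      ... | inj₂ _ | yes refl = inj₁ λ y-on → ∈-subset⁺ C? (inj₂ y-on)
      ... | inj₂ m≢L | no m≢K =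
        inj₂ (s≤s (count≤-if-covered-by-lines m C [] (K i′ ∷ L) m≢ℓ classify))
        where
        m≢ℓ : ∀ t → m ≢ (K i′ ∷ L) t
        m≢ℓ zero    = m≢K
        m≢ℓ (suc j) = m≢L j
        classify : ∀ {y} → y on m → y ∈ C → (∃ λ t → [] t ≡ y) ⊎ (∃ λ t → y on (K i′ ∷ L) t)
        classify y-on y∈C with ∈-subset⁻ C? y∈C
        ... | inj₁ (j , on-L) = inj₂ (suc j , on-L)
        ... | inj₂ on-K = inj₂ (zero , on-K)
      ⊇A-a : ∀ {y} → y ∈ A → y ≢ a i → y ∈ C
      ⊇A-a y∈A y≢a with ∈-subset⁻ InA? y∈A
      ... | inj₁ refl = ∈-subset⁺ C? (inj₁ (zero , O-on-L zero))
      ... | inj₂ (inj₁ refl) = ∈-subset⁺ C? (inj₂ (Y-on-K i′))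
      ... | inj₂ (inj₂ (inj₁ (i″ , refl))) with i″ ≟ i
      ...   | yes refl = ⊥-elim (y≢a refl)
      ...   | no i″≢i rewrite fin2-≢⇒≡ i″≢i (i≢i′ ∘ sym) = ∈-subset⁺ C? (inj₂ (a-on-K i′))
      ⊇A-a y∈A y≢a | inj₂ (inj₂ (inj₂ (j , k , refl))) = ∈-subset⁺ C? (inj₁ (j , P-on-L j k))
      a∉C : a i ∉ C
      a∉C a∈C with ∈-subset⁻ C? a∈C
      ... | inj₁ (j , a-on) = a-not-on-L i j a-on
      ... | inj₂ a-on = a-not-on-K i≢i′ a-on

    blocker-P : ∀ j₀ k₀ → Blocker A (P j₀ k₀)
    blocker-P j₀ k₀ = record
      { set = C ; closed = closed-if-full-or-sparse C full-or-sparse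
      ; ⊇A-x = λ y∈A y≢P → ∈-subset⁺ C? (inj₂ (∈-subset⁻ InA? y∈A , y≢P))
      ; outside = P j₀ k₀ ; outside∉ = P∉C }
      where
      C? : Decidable (λ y → (∃ λ j → j ≢ j₀ × y on L j) ⊎ (InA y × y ≢ P j₀ k₀))
      C? y = any? (λ j → ¬? (j ≟ j₀) ×-dec y on? L j) ⊎-dec (InA? y ×-dec ¬? (y ≟ P j₀ k₀))
      C : Subset (size q)
      C = subset C?
      C⊆Stage₁ : ∀ {y} → y ∈ C → Stage₁ y
      C⊆Stage₁ y∈C with ∈-subset⁻ C? y∈C
      ... | inj₁ (j , _ , on-L) = inj₁ (j , on-L)
      ... | inj₂ (y∈A , _) = A⊆Stage₁ y∈A
      full-or-sparse : ∀ m → (∀ {y} → y on m → y ∈ C) ⊎ count m C < r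
      full-or-sparse m with L? m | K? m
      ... | inj₂ m≢L | inj₂ m≢K = inj₂ (sparse C C⊆Stage₁ m m≢L m≢K)
      ... | inj₁ (j , refl) | _ with j ≟ j₀
      ...   | no j≢j₀ = inj₁ λ y-on → ∈-subset⁺ C? (inj₁ (j , j≢j₀ , y-on))
      ...   | yes refl = inj₂ (s≤s (count≤-if-covered (L j₀) C (O ∷ P j₀ ∘ punchIn k₀) cover))
        where
        cover : ∀ {y} → y on L j₀ → y ∈ C → ∃ λ t → (O ∷ P j₀ ∘ punchIn k₀) t ≡ y
        cover y-on y∈C with ∈-subset⁻ C? y∈C
        ... | inj₁ (j , j≢j₀ , on-L) = zero , sym (L-vertex j≢j₀ on-L y-on)
        ... | inj₂ (y∈A , y≢P) with A-on-L y∈A y-on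
        ...   | inj₁ refl = zero , refl
        ...   | inj₂ (k , refl) with k₀ ≟ k
        ...     | yes refl = ⊥-elim (y≢P refl)
        ...     | no k₀≢k  = suc (punchOut k₀≢k) , cong (P j₀) (punchIn-punchOut k₀≢k)
      full-or-sparse m | inj₂ _ | inj₁ (i , refl) =
        inj₂ (s≤s (count≤-if-covered-by-lines (K i) C (Y ∷ a i ∷ []) (L ∘ punchIn j₀) (λ _ → K≢L i _)
                     classify))
        where
        classify : ∀ {y} → y on K i → y ∈ C →
                   (∃ λ t → (Y ∷ a i ∷ []) t ≡ y) ⊎ (∃ λ t → y on L (punchIn j₀ t))
        classify y-on y∈C with ∈-subset⁻ C? y∈C
        ... | inj₁ (j , j≢j₀ , on-L) =
          inj₂ (punchOut (j≢j₀ ∘ sym) ,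
                subst (λ j → _ on L j) (sym (punchIn-punchOut (j≢j₀ ∘ sym))) on-L)
        ... | inj₂ (y∈A , _) with A-on-K y∈A y-on
        ...   | inj₁ refl = inj₁ (zero , refl)
        ...   | inj₂ refl = inj₁ (suc zero , refl)
      P∉C : P j₀ k₀ ∉ C
      P∉C P∈C with ∈-subset⁻ C? P∈C
      ... | inj₁ (j , j≢j₀ , P-on) = P≢O j₀ k₀ (L-vertex (j≢j₀ ∘ sym) (P-on-L j₀ k₀) P-on)
      ... | inj₂ (_ , P≢P) = P≢P refl

    blocker : ∀ {y} → y ∈ A → Blocker A y
    blocker y∈A with ∈-subset⁻ InA? y∈A
    ... | inj₁ refl = blocker-O
    ... | inj₂ (inj₁ refl) = blocker-Y
    ... | inj₂ (inj₂ (inj₁ (i , refl))) = blocker-a (punchInᵢ≢i i zero ∘ sym)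
    ... | inj₂ (inj₂ (inj₂ (j , k , refl))) = blocker-P j k

    minimal-time-three : 3 + 2 * n ≤ suc q → MinimalPercolating A × iter 2 A ≢ ⊤ × iter 3 A ≡ ⊤
    minimal-time-three lines-fit = minimal-with-time-three A x x∉A₂ (∈A₃ lines-fit) blocker

  configuration : ∀ {n} → 3 + n ≤ q → Configuration n
  configuration {n} 3+n≤q = record
    { O = O ; Y = Y ; x = PointOn.point x-choice ; W = W ; K = K ; L = L ; P = P
    ; O≢Y = O≢Y ; O-on-W = O-on-W ; Y-not-on-W = Y-not-on-W
    ; L-injective = LinesThrough.injective L-choice ; O-on-L = O-on-L ; Y-not-on-L = Y-not-on-L
    ; L≢W = λ j → LinesThrough.avoids L-choice j (suc zero) ∘ sym
    ; K-injective = LinesThrough.injective K-choice ; Y-on-K = Y-on-K ; O-not-on-K = O-not-on-K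
    ; P-injective = PointsOn.injective ∘ P-choice ; P-on-L = PointsOn.on-line ∘ P-choice
    ; P≢O = λ j k → PointsOn.avoids (P-choice j) k zero ∘ sym ; P-not-on-K = P-not-on-K
    ; x-on-OY = PointOn.on-line x-choice
    ; x≢O = PointOn.avoids x-choice zero ∘ sym ; x≢Y = PointOn.avoids x-choice (suc zero) ∘ sym }
    where
    1<1+q : 1 < suc q
    1<1+q = s≤s (≤-trans (s≤s z≤n) q≥2)

    O : Point
    O = somePoint

    Y-choice : PointOn someLine (O ∷ [])
    Y-choice = pointOn someLine (O ∷ []) 1<1+q

    Y : Point
    Y = PointOn.point Y-choice

    O≢Y : O ≢ Y
    O≢Y = PointOn.avoids Y-choice zero

    V : Line
    V = join O Y

    x-choice : PointOn V (O ∷ Y ∷ [])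
    x-choice = pointOn V (O ∷ Y ∷ []) (s≤s q≥2)

    W-choice : LineThrough O (V ∷ [])
    W-choice = lineThrough O (V ∷ []) 1<1+q

    W : Line
    W = LineThrough.line W-choice

    O-on-W : O on W
    O-on-W = LineThrough.through W-choice

    Y-not-on-W : ¬ Y on W
    Y-not-on-W Y-on = LineThrough.avoids W-choice zero (sym (join-unique O≢Y O-on-W Y-on))

    L-choice : LinesThrough n O (V ∷ W ∷ [])
    L-choice = chooseLinesThrough n O (V ∷ W ∷ []) (≤-trans (n≤1+n (2 + n)) (≤-trans 3+n≤q (n≤1+n q)))

    L : Fin n → Line
    L = LinesThrough.line L-choice

    O-on-L : ∀ j → O on L j
    O-on-L = LinesThrough.through L-choice

    Y-not-on-L : ∀ j → ¬ Y on L j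
    Y-not-on-L j Y-on = LinesThrough.avoids L-choice j zero (sym (join-unique O≢Y (O-on-L j) Y-on))

    K-choice : LinesThrough 2 Y (V ∷ [])
    K-choice = chooseLinesThrough 2 Y (V ∷ []) (s≤s q≥2)

    K : Fin 2 → Line
    K = LinesThrough.line K-choice

    Y-on-K : ∀ i → Y on K i
    Y-on-K = LinesThrough.through K-choice

    O-not-on-K : ∀ i → ¬ O on K i
    O-not-on-K i O-on = LinesThrough.avoids K-choice i zero (sym (join-unique O≢Y O-on (Y-on-K i)))

    P-choice : ∀ j → PointsOn (suc n) (L j) (O ∷ λ i → meet (K i) (L j))
    P-choice j = choosePointsOn (suc n) (L j) (O ∷ λ i → meet (K i) (L j)) (s≤s 3+n≤q)

    P : Fin n → Fin (suc n) → Point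
    P = PointsOn.point ∘ P-choice

    P-not-on-K : ∀ i j k → ¬ P j k on K i
    P-not-on-K i j k P-on = PointsOn.avoids (P-choice j) k (suc i)
      (sym (meet-unique (≢-by-point (Y-on-K i) (Y-not-on-L j)) P-on (PointsOn.on-line (P-choice j) k)))

  minimal-percolating-time-three : ∀ s → 6 + 2 * s ≤ q →
    Σ (Subset (size q)) λ A → Percolation.MinimalPercolating Π (4 + s) A
                              × Percolation.iter Π (4 + s) 2 A ≢ ⊤ × Percolation.iter Π (4 + s) 3 A ≡ ⊤
  minimal-percolating-time-three s 6+2s≤q =
    TimeThree.A s cfg , TimeThree.minimal-time-three s cfg (subst (_≤ suc q) (sym (arithmetic s)) (s≤s 6+2s≤q))
    where
    cfg : Configuration (2 + s)
    cfg = configuration (≤-trans (s≤s (s≤s (s≤s (s≤s (s≤s (≤-trans (m≤m+n s _) (n≤1+n _)))))))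
                                 6+2s≤q)
    arithmetic : ∀ s → 3 + 2 * (2 + s) ≡ 7 + 2 * s
    arithmetic = solve-∀

module Quadrilateral {q : ℕ} (Π : ProjectivePlane q) where

  open Counting
  open Geometry Π
  open import Data.Empty using (⊥; ⊥-elim)
  open import Data.Fin using (Fin; zero; suc; _≟_; punchIn; punchOut; opposite; _↑ˡ_; _↑ʳ_)
  open import Data.Fin.Properties
    using (any?; all?; splitAt-↑ˡ; splitAt-↑ʳ; punchInᵢ≢i; punchIn-punchOut; punchIn-injective; opposite-involutive)
  open import Data.Fin.Subset using (Subset; _∈_; _∉_; ⊤)
  open import Data.Nat using (suc; _+_; _≤_; _<_; z≤n; s≤s)
  open import Data.Nat.Properties using (≤-trans; ≤-refl; <⇒≱)
  open import Data.Product using (Σ; ∃; _×_; _,_; proj₁; proj₂)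
  open import Data.Sum using (_⊎_; inj₁; inj₂; [_,_]′)
  open import Data.Vec.Functional using ([]; _∷_; _++_)
  open import Function using (_∘_)
  open import Function.Definitions using (Injective)
  open import Relation.Binary.PropositionalEquality using (_≡_; _≢_; refl; sym; trans; subst; cong)
  open import Relation.Nullary using (Dec; yes; no; ¬_)
  open import Relation.Nullary.Decidable using (True; toWitness; _⊎-dec_; _×-dec_; _→-dec_; ¬?)
  open import Relation.Unary using (Decidable)

  pattern 1ᶠ = suc zero
  pattern 2ᶠ = suc 1ᶠ
  pattern 3ᶠ = suc 2ᶠ
  pattern 4ᶠ = suc 3ᶠ
  pattern 5ᶠ = suc 4ᶠ

  by-decision : {P : Set} (P? : Dec P) → {True P?} → P
  by-decision _ {holds} = toWitness holds

  -- The six pairs of indices of four lines; the pairs t and opposite t are complementary.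
  fst snd : Fin 6 → Fin 4
  fst zero = zero
  fst 1ᶠ   = zero
  fst 2ᶠ   = zero
  fst 3ᶠ   = 1ᶠ
  fst 4ᶠ   = 1ᶠ
  fst 5ᶠ   = 2ᶠ
  snd zero = 1ᶠ
  snd 1ᶠ   = 2ᶠ
  snd 2ᶠ   = 3ᶠ
  snd 3ᶠ   = 2ᶠ
  snd 4ᶠ   = 3ᶠ
  snd 5ᶠ   = 3ᶠ

  infix 4 _∈ₚ_ _∈ₚ?_

  _∈ₚ_ : Fin 4 → Fin 6 → Set
  a ∈ₚ t = a ≡ fst t ⊎ a ≡ snd t

  _∈ₚ?_ : ∀ a t → Dec (a ∈ₚ t)
  a ∈ₚ? t = a ≟ fst t ⊎-dec a ≟ snd t

  abstract
    fst≢snd : ∀ t → fst t ≢ snd t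
    fst≢snd = by-decision (all? λ t → ¬? (fst t ≟ snd t))

    pair-of : ∀ a b → a ≢ b → ∃ λ t → (a ≡ fst t × b ≡ snd t) ⊎ (a ≡ snd t × b ≡ fst t)
    pair-of = by-decision (all? λ a → all? λ b → ¬? (a ≟ b) →-dec
                any? λ t → (a ≟ fst t ×-dec b ≟ snd t) ⊎-dec (a ≟ snd t ×-dec b ≟ fst t))

    pair-unique : ∀ t t′ → fst t′ ∈ₚ t → snd t′ ∈ₚ t → t′ ≡ t
    pair-unique = by-decision (all? λ t → all? λ t′ → fst t′ ∈ₚ? t →-dec snd t′ ∈ₚ? t →-dec t′ ≟ t)

    share-or-opposite : ∀ t t′ → t ≢ t′ → (∃ λ a → a ∈ₚ t × a ∈ₚ t′) ⊎ t′ ≡ opposite t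
    share-or-opposite = by-decision (all? λ (t : Fin 6) → all? λ t′ → ¬? (t ≟ t′) →-dec
                          (any? (λ a → a ∈ₚ? t ×-dec a ∈ₚ? t′) ⊎-dec t′ ≟ opposite t))

    meets-opposite : ∀ t₀ t → t ≢ t₀ → ∃ λ a → a ∈ₚ t × a ∈ₚ opposite t₀
    meets-opposite = by-decision (all? λ (t₀ : Fin 6) → all? λ t → ¬? (t ≟ t₀) →-dec
                       any? λ a → a ∈ₚ? t ×-dec a ∈ₚ? opposite t₀)

    ∈ₚ-or-opposite : ∀ t a → a ∈ₚ t ⊎ a ∈ₚ opposite t
    ∈ₚ-or-opposite = by-decision (all? λ (t : Fin 6) → all? λ a → a ∈ₚ? t ⊎-dec a ∈ₚ? opposite t)

    ∉ₚ-opposite : ∀ t a → a ∈ₚ t → ¬ a ∈ₚ opposite t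
    ∉ₚ-opposite = by-decision (all? λ (t : Fin 6) → all? λ a → a ∈ₚ? t →-dec ¬? (a ∈ₚ? opposite t))

    opposite≢ : ∀ (t : Fin 6) → opposite t ≢ t
    opposite≢ = by-decision (all? λ (t : Fin 6) → ¬? (opposite t ≟ t))

    missing-index : ∀ (a b c : Fin 4) → a ≢ b → b ≢ c → a ≢ c → ∃ λ d → ∀ x → x ≢ d → x ≡ a ⊎ x ≡ b ⊎ x ≡ c
    missing-index = by-decision (all? λ a → all? λ b → all? λ c → ¬? (a ≟ b) →-dec ¬? (b ≟ c) →-dec ¬? (a ≟ c) →-dec
                      any? λ d → all? λ x → ¬? (x ≟ d) →-dec (x ≟ a ⊎-dec x ≟ b ⊎-dec x ≟ c))

    some-pair : ∀ a → ∃ λ t → a ∈ₚ t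
    some-pair = by-decision (all? λ a → any? λ t → a ∈ₚ? t)

    third-index : ∀ (a b : Fin 4) → ∃ λ c → c ≢ a × c ≢ b
    third-index = by-decision (all? λ a → all? λ b → any? λ c → ¬? (c ≟ a) ×-dec ¬? (c ≟ b))

  record Configuration : Set where
    field
      L                   : Fin 4 → Line
      no-three-concurrent : ∀ {y a b c} → a ≢ b → b ≢ c → a ≢ c → y on L a → y on L b → y on L c → ⊥
      e                   : Fin 4 → Point
      e-on-L              : ∀ a → e a on L a
      e-not-on-L          : ∀ {a b} → a ≢ b → ¬ e a on L b
      e₃-not-on-e₀e₁      : ¬ e 3ᶠ on join (e zero) (e 1ᶠ)

  module TimeThree (q≡5 : q ≡ 5) (cfg : Configuration) where

    open Configuration cfg
    open Percolating 4

    L≢L : ∀ {a b} → a ≢ b → L a ≢ L b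
    L≢L a≢b = ≢-by-point (e-on-L _) (e-not-on-L a≢b)

    concurrent : ∀ {y a b c} → a ≢ b → y on L a → y on L b → y on L c → c ≡ a ⊎ c ≡ b
    concurrent {a = a} {b} {c} a≢b y-a y-b y-c with c ≟ a | c ≟ b
    ... | yes c≡a | _ = inj₁ c≡a
    ... | no _ | yes c≡b = inj₂ c≡b
    ... | no c≢a | no c≢b = ⊥-elim (no-three-concurrent a≢b (c≢b ∘ sym) (c≢a ∘ sym) y-a y-b y-c)

    v : Fin 6 → Point
    v t = meet (L (fst t)) (L (snd t))

    Lfst≢Lsnd : ∀ t → L (fst t) ≢ L (snd t)
    Lfst≢Lsnd t = L≢L (fst≢snd t)

    v-on : ∀ {a t} → a ∈ₚ t → v t on L a
    v-on {t = t} (inj₁ refl) = meet-onˡ (Lfst≢Lsnd t)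
    v-on {t = t} (inj₂ refl) = meet-onʳ (Lfst≢Lsnd t)

    v-on-fst : ∀ t → v t on L (fst t)
    v-on-fst t = v-on (inj₁ refl)

    v-on-snd : ∀ t → v t on L (snd t)
    v-on-snd t = v-on (inj₂ refl)

    v-off : ∀ {a t} → ¬ a ∈ₚ t → ¬ v t on L a
    v-off {t = t} a∉t v-on-a = a∉t (concurrent (fst≢snd t) (v-on-fst t) (v-on-snd t) v-on-a)

    vertex-is-v : ∀ {y a b} → a ≢ b → y on L a → y on L b → ∃ λ t → y ≡ v t
    vertex-is-v a≢b y-a y-b with pair-of _ _ a≢b
    ... | t , inj₁ (refl , refl) = t , meet-unique (Lfst≢Lsnd t) y-a y-b
    ... | t , inj₂ (refl , refl) = t , meet-unique (Lfst≢Lsnd t) y-b y-a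

    v-injective : Injective _≡_ _≡_ v
    v-injective {t} {t′} eq = sym (pair-unique t t′
      (concurrent (fst≢snd t) (v-on-fst t) (v-on-snd t) (subst (_on _) (sym eq) (v-on-fst t′)))
      (concurrent (fst≢snd t) (v-on-fst t) (v-on-snd t) (subst (_on _) (sym eq) (v-on-snd t′))))

    v≢e : ∀ t a → v t ≢ e a
    v≢e t a eq with a ≟ fst t
    ... | yes refl = e-not-on-L (fst≢snd t) (subst (_on _) eq (v-on-snd t))
    ... | no a≢fst = e-not-on-L (a≢fst) (subst (_on _) eq (v-on-fst t))

    D : Fin 6 → Line
    D t = join (v t) (v (opposite t))

    v≢v-opposite : ∀ t → v t ≢ v (opposite t)
    v≢v-opposite t = opposite≢ t ∘ v-injective ∘ sym

    v-on-D : ∀ t → v t on D t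
    v-on-D t = join-onˡ (v≢v-opposite t)

    v-opposite-on-D : ∀ t → v (opposite t) on D t
    v-opposite-on-D t = join-onʳ (v≢v-opposite t)

    D-opposite : ∀ t → D (opposite t) ≡ D t
    D-opposite t = join-unique (v≢v-opposite t) (subst (λ t′ → v t′ on D (opposite t)) (opposite-involutive t)
                                 (v-opposite-on-D (opposite t))) (v-on-D (opposite t))

    D≢L : ∀ t a → D t ≢ L a
    D≢L t a with ∈ₚ-or-opposite t a
    ... | inj₁ a∈t = ≢-by-point (v-opposite-on-D t) (v-off (∉ₚ-opposite t a a∈t))
    ... | inj₂ a∈opp = ≢-by-point (v-on-D t) (v-off λ a∈t → ∉ₚ-opposite t a a∈t a∈opp)

    two-vertices : ∀ {m t t′} → t ≢ t′ → v t on m → v t′ on m → (∃ λ a → m ≡ L a) ⊎ m ≡ D t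
    two-vertices {t = t} {t′} t≢t′ vt-on vt′-on with share-or-opposite t t′ t≢t′
    ... | inj₁ (a , a∈t , a∈t′) = inj₁ (a , line-unique (t≢t′ ∘ v-injective) vt-on vt′-on (v-on a∈t) (v-on a∈t′))
    ... | inj₂ refl = inj₂ (join-unique (v≢v-opposite t) vt-on vt′-on)

    D-meets-L : ∀ {y t a} → y on D t → y on L a → y ≡ v t ⊎ y ≡ v (opposite t)
    D-meets-L {t = t} {a} y-D y-L with ∈ₚ-or-opposite t a
    ... | inj₁ a∈t   = inj₁ (point-unique (D≢L t a) y-D y-L (v-on-D t) (v-on a∈t))
    ... | inj₂ a∈opp = inj₂ (point-unique (D≢L t a) y-D y-L (v-opposite-on-D t) (v-on a∈opp))

    v-not-on-D : ∀ {t t′} → t′ ≢ t → t′ ≢ opposite t → ¬ v t′ on D t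
    v-not-on-D {t} {t′} t′≢t t′≢opp v-on-D′ with share-or-opposite t t′ (t′≢t ∘ sym)
    ... | inj₁ (a , a∈t , a∈t′) =
      D≢L t a (line-unique (t′≢t ∘ sym ∘ v-injective) (v-on-D t) v-on-D′ (v-on a∈t) (v-on a∈t′))
    ... | inj₂ t′≡opp = t′≢opp t′≡opp

    InA : Point → Set
    InA y = (∃ λ t → y ≡ v t) ⊎ (∃ λ a → y ≡ e a)

    InA? : Decidable InA
    InA? y = any? (λ t → y ≟ v t) ⊎-dec any? (λ a → y ≟ e a)

    A A₁ A₂ : Subset (size q)
    A  = subset InA?
    A₁ = step A
    A₂ = step A₁

    OnL : Point → Set
    OnL y = ∃ λ a → y on L a

    A⊆OnL : ∀ {y} → InA y → OnL y
    A⊆OnL (inj₁ (t , refl)) = fst t , v-on-fst t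
    A⊆OnL (inj₂ (a , refl)) = a , e-on-L a

    on-other-L : ∀ {y a b} → a ≢ b → y on L b → ∃ λ u → y on L (punchIn a u)
    on-other-L a≢b y-on = punchOut a≢b , subst (λ b → _ on L b) (sym (punchIn-punchOut a≢b)) y-on

    through-vertex-sparse : ∀ S → (∀ {y} → y ∈ S → OnL y) → ∀ m t → (∀ a → m ≢ L a) → v t on m →
                            count m S < 4
    through-vertex-sparse S S⊆ m t m≢L vt-on =
      s≤s (count≤-if-covered-by-lines m S [] (L ∘ punchIn (snd t)) (λ _ → m≢L _) classify)
      where
      classify : ∀ {y} → y on m → y ∈ S → (∃ λ i → [] i ≡ y) ⊎ (∃ λ u → y on L (punchIn (snd t) u))
      classify y-on y∈S with S⊆ y∈S
      ... | a , y-on-L with snd t ≟ a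
      ...   | no snd≢a = inj₂ (on-other-L snd≢a y-on-L)
      ...   | yes refl = inj₂ (on-other-L (fst≢snd t ∘ sym)
                          (subst (_on L (fst t)) (sym (point-unique (m≢L _) y-on y-on-L vt-on (v-on-snd t))) (v-on-fst t)))

    e₀≢e₁ : e zero ≢ e 1ᶠ
    e₀≢e₁ = ≢-by-line (e-on-L zero) (e-not-on-L (λ ()))

    e-missing : ∀ m → ∃ λ k → ¬ e k on m
    e-missing m with e zero on? m | e 1ᶠ on? m
    ... | no off₀ | _ = zero , off₀
    ... | yes _ | no off₁ = 1ᶠ , off₁
    ... | yes on₀ | yes on₁ = 3ᶠ ,
      λ on₃ → e₃-not-on-e₀e₁ (subst (_ on_) (join-unique e₀≢e₁ on₀ on₁) on₃)

    sparse-A : ∀ m → (∀ a → m ≢ L a) → count m A < 4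
    sparse-A m m≢L with any? (λ t → v t on? m)
    ... | yes (t , vt-on) = through-vertex-sparse A (A⊆OnL ∘ ∈-subset⁻ InA?) m t m≢L vt-on
    ... | no no-vertex with e-missing m
    ...   | k , e-k-off = s≤s (count≤-if-covered m A (e ∘ punchIn k) cover)
      where
      cover : ∀ {y} → y on m → y ∈ A → ∃ λ u → e (punchIn k u) ≡ y
      cover y-on y∈A with ∈-subset⁻ InA? y∈A
      ... | inj₁ (t , refl) = ⊥-elim (no-vertex (t , y-on))
      ... | inj₂ (a , refl) with k ≟ a
      ...   | yes refl = ⊥-elim (e-k-off y-on)
      ...   | no k≢a = punchOut k≢a , cong e (punchIn-punchOut k≢a)

    on-L⇒∈A₁ : ∀ a {y} → y on L a → y ∈ A₁
    on-L⇒∈A₁ a y-on = ∈-step⁺ A (L a) y-on (≤count-if-injective (L a) A f f-injective f-on f∈A)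
      where
      a≢ : ∀ u → a ≢ punchIn a u
      a≢ u = punchInᵢ≢i a u ∘ sym
      f = e a ∷ meet (L a) ∘ L ∘ punchIn a
      f-injective : Injective _≡_ _≡_ f
      f-injective = ∷-injective
        (meets-injective (L a) (L ∘ punchIn a) (L≢L ∘ a≢) λ u≢u′ z-a z-u z-u′ →
          no-three-concurrent (a≢ _) (u≢u′ ∘ punchIn-injective a _ _) (a≢ _) z-a z-u z-u′)
        λ u eq → e-not-on-L (a≢ u) (subst (_on L (punchIn a u)) eq (meet-onʳ (L≢L (a≢ u))))
      f-on : ∀ i → f i on L a
      f-on zero    = e-on-L a
      f-on (suc u) = meet-onˡ (L≢L (a≢ u))
      f∈A : ∀ i → f i ∈ A
      f∈A zero    = ∈-subset⁺ InA? (inj₂ (a , refl))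
      f∈A (suc u) = ∈-subset⁺ InA? (inj₁ (vertex-is-v (a≢ u) (meet-onˡ (L≢L (a≢ u))) (meet-onʳ (L≢L (a≢ u)))))

    A₁⊆OnL : ∀ {y} → y ∈ A₁ → OnL y
    A₁⊆OnL y∈A₁ with ∈-step⁻ A y∈A₁
    ... | inj₁ y∈A = A⊆OnL (∈-subset⁻ InA? y∈A)
    ... | inj₂ (m , y-on , 4≤) with any? (λ a → m ≟ L a)
    ...   | yes (a , refl) = a , y-on
    ...   | no m≢L = ⊥-elim (<⇒≱ (sparse-A m λ a eq → m≢L (a , eq)) 4≤)

    vertex-free⇒⊆A₂ : ∀ m → (∀ t → ¬ v t on m) → ∀ {y} → y on m → y ∈ A₂
    vertex-free⇒⊆A₂ m no-vertex = ∈-step-if-transversal A₁ L m m≢L meet-vertex on-L⇒∈A₁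
      where
      m≢L : ∀ a → m ≢ L a
      m≢L a = ≢-by-point (v-on (proj₂ (some-pair a))) (no-vertex _) ∘ sym
      meet-vertex : ∀ {z a b} → a ≢ b → z on m → z on L a → z on L b → ⊥
      meet-vertex a≢b z-on z-a z-b with vertex-is-v a≢b z-a z-b
      ... | t , refl = no-vertex t z-on

    5<1+q : 5 < suc q
    5<1+q = subst (λ n → 5 < suc n) (sym q≡5) ≤-refl

    -- Through a point of a diagonal, the six vertices span at most five lines, so a sixth one avoids them.
    on-D⇒∈A₂ : ∀ {y} t₀ → (∀ a → ¬ y on L a) → y on D t₀ → y ∈ A₂
    on-D⇒∈A₂ {y} t₀ off-L y-on-D = vertex-free⇒⊆A₂ m no-vertex y-on-m
      where
      avoided : Fin 5 → Line
      avoided u = join y (v (punchIn t₀ u))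
      m-choice : LineThrough y avoided
      m-choice = lineThrough y avoided 5<1+q
      m : Line
      m = LineThrough.line m-choice
      y-on-m : y on m
      y-on-m = LineThrough.through m-choice
      y≢v : ∀ t → y ≢ v t
      y≢v t refl = off-L _ (v-on-fst t)
      other-vertex-not-on-m : ∀ t → t₀ ≢ t → ¬ v t on m
      other-vertex-not-on-m t t₀≢t vt-on = LineThrough.avoids m-choice (punchOut t₀≢t)
        (trans (cong (join y ∘ v) (punchIn-punchOut t₀≢t)) (sym (join-unique (y≢v t) y-on-m vt-on)))
      no-vertex : ∀ t → ¬ v t on m
      no-vertex t vt-on with t₀ ≟ t
      ... | no t₀≢t = other-vertex-not-on-m t t₀≢t vt-on
      ... | yes refl = other-vertex-not-on-m (opposite t₀) (opposite≢ t₀ ∘ sym)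
        (subst (v (opposite t₀) on_) (line-unique (y≢v t₀) y-on-D (v-on-D t₀) y-on-m vt-on) (v-opposite-on-D t₀))

    -- A point y off the lines and diagonals is joined to the vertex v zero by a line m carrying no
    -- other vertex; m meets L 2ᶠ, L 3ᶠ and the diagonal D 1ᶠ in three more points of A₂.
    module _ {y : Point} (off-L : ∀ a → ¬ y on L a) (off-D : ∀ t → ¬ y on D t) where

      private
        y≢v₀ : y ≢ v zero
        y≢v₀ refl = off-L zero (v-on-fst zero)

        m : Line
        m = join y (v zero)

        y-on-m : y on m
        y-on-m = join-onˡ y≢v₀

        v₀-on-m : v zero on m
        v₀-on-m = join-onʳ y≢v₀

        m≢L : ∀ a → m ≢ L a
        m≢L a = ≢-by-point y-on-m (off-L a)

        only-v₀ : ∀ t → v t on m → t ≡ zero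
        only-v₀ t vt-on with t ≟ zero
        ... | yes t≡0 = t≡0
        ... | no t≢0 with two-vertices (t≢0 ∘ sym) v₀-on-m vt-on
        ...   | inj₁ (a , m≡L) = ⊥-elim (m≢L a m≡L)
        ...   | inj₂ m≡D = ⊥-elim (off-D zero (subst (y on_) m≡D y-on-m))

        m≢D₁ : m ≢ D 1ᶠ
        m≢D₁ = ≢-by-point y-on-m (off-D 1ᶠ)

        z : Point
        z = meet m (D 1ᶠ)

        z-off-L : ∀ a → ¬ z on L a
        z-off-L a z-on with D-meets-L {t = 1ᶠ} (meet-onʳ m≢D₁) z-on
        ... | inj₁ z≡v with only-v₀ 1ᶠ (subst (_on m) z≡v (meet-onˡ m≢D₁))
        ...   | ()
        z-off-L a z-on | inj₂ z≡v with only-v₀ (opposite 1ᶠ) (subst (_on m) z≡v (meet-onˡ m≢D₁))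
        ...   | ()

        meet≢v₀ : ∀ a → ¬ a ∈ₚ zero → meet m (L a) ≢ v zero
        meet≢v₀ a a∉ = meet≢-if-not-on (m≢L a) (v-off {t = zero} a∉)

        f : Fin 4 → Point
        f = v zero ∷ meet m (L 2ᶠ) ∷ meet m (L 3ᶠ) ∷ z ∷ []

        f-injective : Injective _≡_ _≡_ f
        f-injective = ∷-injective (∷-injective (∷-injective singleton-injective
          λ { zero eq → z-off-L 3ᶠ (subst (_on L 3ᶠ) (sym eq) (meet-onʳ (m≢L 3ᶠ))) })
          λ { zero eq → meet₂≢meet₃ (sym eq) ; 1ᶠ eq → z-off-L 2ᶠ (subst (_on L 2ᶠ) (sym eq) (meet-onʳ (m≢L 2ᶠ))) })
          λ { zero → meet≢v₀ 2ᶠ (λ { (inj₁ ()) ; (inj₂ ()) })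
            ; 1ᶠ → meet≢v₀ 3ᶠ (λ { (inj₁ ()) ; (inj₂ ()) })
            ; 2ᶠ eq → z-off-L zero (subst (_on L zero) (sym eq) (v-on-fst zero)) }
          where
          singleton-injective : Injective _≡_ _≡_ (z ∷ [])
          singleton-injective {zero} {zero} _ = refl
          meet₂≢meet₃ : meet m (L 2ᶠ) ≢ meet m (L 3ᶠ)
          meet₂≢meet₃ eq with vertex-is-v (λ ()) (meet-onʳ (m≢L 2ᶠ)) (subst (_on L 3ᶠ) (sym eq) (meet-onʳ (m≢L 3ᶠ)))
          ... | t , w≡v with only-v₀ t (subst (_on m) w≡v (meet-onˡ (m≢L 2ᶠ)))
          ...   | refl = meet≢v₀ 2ᶠ (λ { (inj₁ ()) ; (inj₂ ()) }) w≡v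

        f-on : ∀ i → f i on m
        f-on zero = v₀-on-m
        f-on 1ᶠ   = meet-onˡ (m≢L 2ᶠ)
        f-on 2ᶠ   = meet-onˡ (m≢L 3ᶠ)
        f-on 3ᶠ   = meet-onˡ m≢D₁

        f∈A₂ : ∀ i → f i ∈ A₂
        f∈A₂ zero = ⊆-step A₁ (on-L⇒∈A₁ zero (v-on-fst zero))
        f∈A₂ 1ᶠ   = ⊆-step A₁ (on-L⇒∈A₁ 2ᶠ (meet-onʳ (m≢L 2ᶠ)))
        f∈A₂ 2ᶠ   = ⊆-step A₁ (on-L⇒∈A₁ 3ᶠ (meet-onʳ (m≢L 3ᶠ)))
        f∈A₂ 3ᶠ   = on-D⇒∈A₂ 1ᶠ z-off-L (meet-onʳ m≢D₁)

      off-diagonals⇒∈A₃ : y ∈ step A₂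
      off-diagonals⇒∈A₃ = ∈-step⁺ A₂ m y-on-m (≤count-if-injective m A₂ f f-injective f-on f∈A₂)

    ∈A₃ : ∀ y → y ∈ step A₂
    ∈A₃ y with any? (λ a → y on? L a) | any? (λ t → y on? D t)
    ... | yes (a , y-on) | _ = ⊆-step A₂ (⊆-step A₁ (on-L⇒∈A₁ a y-on))
    ... | no off-L | yes (t , y-on) = ⊆-step A₂ (on-D⇒∈A₂ t (λ a y-on → off-L (a , y-on)) y-on)
    ... | no off-L | no off-D = off-diagonals⇒∈A₃ (λ a y-on → off-L (a , y-on)) (λ t y-on → off-D (t , y-on))

    private
      3<1+q : 3 < suc q
      3<1+q = ≤-trans (s≤s (s≤s (s≤s (s≤s z≤n)))) 5<1+q

      ℓ₀-choice : LineThrough (v zero) (L zero ∷ L 1ᶠ ∷ D zero ∷ [])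
      ℓ₀-choice = lineThrough (v zero) (L zero ∷ L 1ᶠ ∷ D zero ∷ []) 3<1+q

      ℓ₀ : Line
      ℓ₀ = LineThrough.line ℓ₀-choice

      v₀-on-ℓ₀ : v zero on ℓ₀
      v₀-on-ℓ₀ = LineThrough.through ℓ₀-choice

      ℓ₀≢L : ∀ a → ℓ₀ ≢ L a
      ℓ₀≢L zero = LineThrough.avoids ℓ₀-choice zero ∘ sym
      ℓ₀≢L 1ᶠ   = LineThrough.avoids ℓ₀-choice 1ᶠ ∘ sym
      ℓ₀≢L 2ᶠ   = ≢-by-point v₀-on-ℓ₀ (v-off {t = zero} λ { (inj₁ ()) ; (inj₂ ()) })
      ℓ₀≢L 3ᶠ   = ≢-by-point v₀-on-ℓ₀ (v-off {t = zero} λ { (inj₁ ()) ; (inj₂ ()) })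

      ℓ₀≢D₀ : ℓ₀ ≢ D zero
      ℓ₀≢D₀ = LineThrough.avoids ℓ₀-choice 2ᶠ ∘ sym

      ℓ₀≢D₁ : ℓ₀ ≢ D 1ᶠ
      ℓ₀≢D₁ = ≢-by-point v₀-on-ℓ₀ (v-not-on-D {1ᶠ} {zero} (λ ()) (λ ()))

      ℓ₀≢D₂ : ℓ₀ ≢ D 2ᶠ
      ℓ₀≢D₂ = ≢-by-point v₀-on-ℓ₀ (v-not-on-D {2ᶠ} {zero} (λ ()) (λ ()))

      -- ℓ₀ has six points: v zero, its meets with L 2ᶠ, L 3ᶠ, D 1ᶠ, D 2ᶠ, and x₀.
      x₀-choice : PointOn ℓ₀ (v zero ∷ meet ℓ₀ (L 2ᶠ) ∷ meet ℓ₀ (L 3ᶠ) ∷ meet ℓ₀ (D 1ᶠ) ∷ meet ℓ₀ (D 2ᶠ) ∷ [])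
      x₀-choice = pointOn ℓ₀ _ 5<1+q

    x₀ : Point
    x₀ = PointOn.point x₀-choice

    private
      x₀-on-ℓ₀ : x₀ on ℓ₀
      x₀-on-ℓ₀ = PointOn.on-line x₀-choice

      x₀-avoids : ∀ i → (v zero ∷ meet ℓ₀ (L 2ᶠ) ∷ meet ℓ₀ (L 3ᶠ) ∷ meet ℓ₀ (D 1ᶠ) ∷ meet ℓ₀ (D 2ᶠ) ∷ []) i ≢ x₀
      x₀-avoids = PointOn.avoids x₀-choice

    x₀-off-L : ∀ a → ¬ x₀ on L a
    x₀-off-L zero x₀-on = x₀-avoids zero (sym (point-unique (ℓ₀≢L zero) x₀-on-ℓ₀ x₀-on v₀-on-ℓ₀ (v-on-fst zero)))
    x₀-off-L 1ᶠ x₀-on = x₀-avoids zero (sym (point-unique (ℓ₀≢L 1ᶠ) x₀-on-ℓ₀ x₀-on v₀-on-ℓ₀ (v-on-snd zero)))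
    x₀-off-L 2ᶠ x₀-on = x₀-avoids 1ᶠ (sym (meet-unique (ℓ₀≢L 2ᶠ) x₀-on-ℓ₀ x₀-on))
    x₀-off-L 3ᶠ x₀-on = x₀-avoids 2ᶠ (sym (meet-unique (ℓ₀≢L 3ᶠ) x₀-on-ℓ₀ x₀-on))

    x₀-off-D : ∀ t → ¬ x₀ on D t
    x₀-off-D zero x₀-on = x₀-avoids zero (sym (point-unique ℓ₀≢D₀ x₀-on-ℓ₀ x₀-on v₀-on-ℓ₀ (v-on-D zero)))
    x₀-off-D 1ᶠ x₀-on = x₀-avoids 3ᶠ (sym (meet-unique ℓ₀≢D₁ x₀-on-ℓ₀ x₀-on))
    x₀-off-D 2ᶠ x₀-on = x₀-avoids 4ᶠ (sym (meet-unique ℓ₀≢D₂ x₀-on-ℓ₀ x₀-on))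
    x₀-off-D 3ᶠ x₀-on = x₀-off-D 2ᶠ (subst (x₀ on_) (D-opposite 2ᶠ) x₀-on)
    x₀-off-D 4ᶠ x₀-on = x₀-off-D 1ᶠ (subst (x₀ on_) (D-opposite 1ᶠ) x₀-on)
    x₀-off-D 5ᶠ x₀-on = x₀-off-D zero (subst (x₀ on_) (D-opposite zero) x₀-on)

    x₀≢v : ∀ t → x₀ ≢ v t
    x₀≢v t eq = x₀-off-L _ (subst (_on L (fst t)) (sym eq) (v-on-fst t))

    join-x₀-injective : Injective _≡_ _≡_ (join x₀ ∘ v)
    join-x₀-injective {t} {t′} eq with t ≟ t′
    ... | yes t≡t′ = t≡t′
    ... | no t≢t′ with two-vertices t≢t′ (join-onʳ (x₀≢v t)) (subst (v t′ on_) (sym eq) (join-onʳ (x₀≢v t′)))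
    ...   | inj₁ (a , j≡L) = ⊥-elim (x₀-off-L a (subst (x₀ on_) j≡L (join-onˡ (x₀≢v t))))
    ...   | inj₂ j≡D = ⊥-elim (x₀-off-D t (subst (x₀ on_) j≡D (join-onˡ (x₀≢v t))))

    -- The six joins of x₀ to the vertices are distinct, hence they are all the lines through x₀.
    vertex-on-line-through-x₀ : ∀ {m} → x₀ on m → ∃ λ t → v t on m
    vertex-on-line-through-x₀ x₀-on with injective⇒covers (linesThrough x₀) (join x₀ ∘ v) join-x₀-injective
                                        (λ t → on⇒∈linesThrough (join-onˡ (x₀≢v t)))
                                        (subst (_≤ 6) (sym (trans (pointDeg x₀) (cong suc q≡5))) ≤-refl)
                                        (on⇒∈linesThrough x₀-on)
    ... | t , refl = t , join-onʳ (x₀≢v t)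

    x₀∉A₂ : x₀ ∉ A₂
    x₀∉A₂ x₀∈ with ∈-step⁻ A₁ x₀∈
    ... | inj₁ x₀∈A₁ = x₀-off-L _ (proj₂ (A₁⊆OnL x₀∈A₁))
    ... | inj₂ (m , x₀-on , 4≤) with vertex-on-line-through-x₀ x₀-on
    ...   | t , vt-on = <⇒≱ (through-vertex-sparse A₁ A₁⊆OnL m t (≢-by-point x₀-on ∘ x₀-off-L) vt-on) 4≤

    blocker-e : ∀ a → Blocker A (e a)
    blocker-e a = record
      { set = C ; closed = closed-if-full-or-sparse C full-or-sparse
      ; ⊇A-x = ⊇A-e ; outside = e a ; outside∉ = e∉C }
      where
      C? : Decidable (λ y → ∃ λ b → b ≢ a × y on L b)
      C? y = any? (λ b → ¬? (b ≟ a) ×-dec y on? L b)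
      C : Subset (size q)
      C = subset C?
      full-or-sparse : ∀ m → (∀ {y} → y on m → y ∈ C) ⊎ count m C < 4
      full-or-sparse m with any? (λ b → ¬? (b ≟ a) ×-dec m ≟ L b)
      ... | yes (b , b≢a , refl) = inj₁ λ y-on → ∈-subset⁺ C? (b , b≢a , y-on)
      ... | no m-other = inj₂ (s≤s (count≤-if-covered-by-lines m C [] (L ∘ punchIn a)
                          (λ u eq → m-other (punchIn a u , punchInᵢ≢i a u , eq)) classify))
        where
        classify : ∀ {y} → y on m → y ∈ C → (∃ λ i → [] i ≡ y) ⊎ (∃ λ u → y on L (punchIn a u))
        classify _ y∈C with ∈-subset⁻ C? y∈C
        ... | b , b≢a , y-on = inj₂ (on-other-L (b≢a ∘ sym) y-on)
      ⊇A-e : ∀ {y} → y ∈ A → y ≢ e a → y ∈ C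
      ⊇A-e y∈A y≢e with ∈-subset⁻ InA? y∈A
      ... | inj₁ (t , refl) with fst t ≟ a
      ...   | yes refl = ∈-subset⁺ C? (snd t , fst≢snd t ∘ sym , v-on-snd t)
      ...   | no fst≢a = ∈-subset⁺ C? (fst t , fst≢a , v-on-fst t)
      ⊇A-e y∈A y≢e | inj₂ (b , refl) with b ≟ a
      ...   | yes refl = ⊥-elim (y≢e refl)
      ...   | no b≢a = ∈-subset⁺ C? (b , b≢a , e-on-L b)
      e∉C : e a ∉ C
      e∉C e∈C with ∈-subset⁻ C? e∈C
      ... | b , b≢a , e-on = e-not-on-L (b≢a ∘ sym) e-on

    blocker-v : ∀ t₀ → Blocker A (v t₀)
    blocker-v t₀ = record
      { set = C ; closed = closed-if-full-or-sparse C full-or-sparse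
      ; ⊇A-x = ⊇A-v ; outside = v t₀ ; outside∉ = v∉C }
      where
      e≢e : e (fst t₀) ≢ e (snd t₀)
      e≢e = ≢-by-line (e-on-L _) (e-not-on-L (fst≢snd t₀ ∘ sym))
      M : Line
      M = join (e (fst t₀)) (e (snd t₀))
      ℓ : Fin 3 → Line
      ℓ = L (fst (opposite t₀)) ∷ L (snd (opposite t₀)) ∷ M ∷ []
      C? : Decidable (λ y → ∃ λ i → y on ℓ i)
      C? y = any? (λ i → y on? ℓ i)
      C : Subset (size q)
      C = subset C?
      full-or-sparse : ∀ m → (∀ {y} → y on m → y ∈ C) ⊎ count m C < 4
      full-or-sparse m with any? (λ i → m ≟ ℓ i)
      ... | yes (i , refl) = inj₁ λ y-on → ∈-subset⁺ C? (i , y-on)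
      ... | no m≢ℓ = inj₂ (s≤s (count≤-if-covered-by-lines m C [] ℓ (λ i eq → m≢ℓ (i , eq))
                                  λ _ y∈C → inj₂ (∈-subset⁻ C? y∈C)))
      on-opposite-L : ∀ {y a} → a ∈ₚ opposite t₀ → y on L a → y ∈ C
      on-opposite-L (inj₁ refl) y-on = ∈-subset⁺ C? (zero , y-on)
      on-opposite-L (inj₂ refl) y-on = ∈-subset⁺ C? (1ᶠ , y-on)
      ⊇A-v : ∀ {y} → y ∈ A → y ≢ v t₀ → y ∈ C
      ⊇A-v y∈A y≢v with ∈-subset⁻ InA? y∈A
      ... | inj₁ (t , refl) with meets-opposite t₀ t (y≢v ∘ cong v)
      ...   | a , a∈t , a∈opp = on-opposite-L a∈opp (v-on a∈t)
      ⊇A-v y∈A y≢v | inj₂ (b , refl) with ∈ₚ-or-opposite t₀ b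
      ...   | inj₁ (inj₁ refl) = ∈-subset⁺ C? (2ᶠ , join-onˡ e≢e)
      ...   | inj₁ (inj₂ refl) = ∈-subset⁺ C? (2ᶠ , join-onʳ e≢e)
      ...   | inj₂ b∈opp = on-opposite-L b∈opp (e-on-L b)
      v∉C : v t₀ ∉ C
      v∉C v∈C with ∈-subset⁻ C? v∈C
      ... | zero , v-on-L = v-off (λ a∈ → ∉ₚ-opposite t₀ _ a∈ (inj₁ refl)) v-on-L
      ... | 1ᶠ , v-on-L = v-off (λ a∈ → ∉ₚ-opposite t₀ _ a∈ (inj₂ refl)) v-on-L
      ... | 2ᶠ , v-on-M = e-not-on-L (fst≢snd t₀ ∘ sym)
        (subst (e (snd t₀) on_) (line-unique (v≢e t₀ _) v-on-M (join-onˡ e≢e) (v-on-fst t₀) (e-on-L _)) (join-onʳ e≢e))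

    blocker : ∀ {y} → y ∈ A → Blocker A y
    blocker y∈A with ∈-subset⁻ InA? y∈A
    ... | inj₁ (t , refl) = blocker-v t
    ... | inj₂ (a , refl) = blocker-e a

    minimal-time-three : MinimalPercolating A × iter 2 A ≢ ⊤ × iter 3 A ≡ ⊤
    minimal-time-three = minimal-with-time-three A x₀ x₀∉A₂ ∈A₃ blocker

  module Construction (q≡5 : q ≡ 5) where

    private
      n<1+q : ∀ {n} → n ≤ 5 → n < suc q
      n<1+q n≤5 = s≤s (subst (_ ≤_) (sym q≡5) n≤5)

      L₀ : Line
      L₀ = someLine

      P₀-choice : PointOn L₀ []
      P₀-choice = pointOn L₀ [] (s≤s z≤n)

      P₀ : Point
      P₀ = PointOn.point P₀-choice

      P₀-on-L₀ : P₀ on L₀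
      P₀-on-L₀ = PointOn.on-line P₀-choice

      L₁-choice : LineThrough P₀ (L₀ ∷ [])
      L₁-choice = lineThrough P₀ (L₀ ∷ []) (n<1+q (s≤s z≤n))

      L₁ : Line
      L₁ = LineThrough.line L₁-choice

      P₀-on-L₁ : P₀ on L₁
      P₀-on-L₁ = LineThrough.through L₁-choice

      L₀≢L₁ : L₀ ≢ L₁
      L₀≢L₁ = LineThrough.avoids L₁-choice zero

      u-choice : PointsOn 2 L₀ (P₀ ∷ [])
      u-choice = choosePointsOn 2 L₀ (P₀ ∷ []) (n<1+q (s≤s (s≤s z≤n)))

      w-choice : PointsOn 2 L₁ (P₀ ∷ [])
      w-choice = choosePointsOn 2 L₁ (P₀ ∷ []) (n<1+q (s≤s (s≤s z≤n)))

      u w : Fin 2 → Point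
      u = PointsOn.point u-choice
      w = PointsOn.point w-choice

      u-on : ∀ i → u i on L₀
      u-on = PointsOn.on-line u-choice

      w-on : ∀ i → w i on L₁
      w-on = PointsOn.on-line w-choice

      u≢P₀ : ∀ i → u i ≢ P₀
      u≢P₀ i = PointsOn.avoids u-choice i zero ∘ sym

      w≢P₀ : ∀ i → w i ≢ P₀
      w≢P₀ i = PointsOn.avoids w-choice i zero ∘ sym

      u≢w : ∀ i → u i ≢ w i
      u≢w i eq = u≢P₀ i (point-unique L₀≢L₁ (u-on i) (subst (_on L₁) (sym eq) (w-on i)) P₀-on-L₀ P₀-on-L₁)

      cross : Fin 2 → Line
      cross i = join (u i) (w i)

      meets-at : ∀ {ℓ ℓ′ m x p y} → ℓ ≢ ℓ′ → P₀ on ℓ → P₀ on ℓ′ → x on ℓ → p on ℓ′ → p ≢ P₀ →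
                 x on m → p on m → y on ℓ → y on m → y ≡ x
      meets-at {m = m} ℓ≢ℓ′ P₀-ℓ P₀-ℓ′ x-ℓ p-ℓ′ p≢P₀ x-m p-m y-ℓ y-m = point-unique ℓ≢m y-ℓ y-m x-ℓ x-m
        where
        ℓ≢m : _ ≢ m
        ℓ≢m refl = p≢P₀ (point-unique ℓ≢ℓ′ p-m p-ℓ′ P₀-ℓ P₀-ℓ′)

      on-cross-L₀ : ∀ {i y} → y on L₀ → y on cross i → y ≡ u i
      on-cross-L₀ {i} = meets-at L₀≢L₁ P₀-on-L₀ P₀-on-L₁ (u-on i) (w-on i) (w≢P₀ i)
                          (join-onˡ (u≢w i)) (join-onʳ (u≢w i))

      on-cross-L₁ : ∀ {i y} → y on L₁ → y on cross i → y ≡ w i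
      on-cross-L₁ {i} = meets-at (L₀≢L₁ ∘ sym) P₀-on-L₁ P₀-on-L₀ (w-on i) (u-on i) (u≢P₀ i)
                          (join-onʳ (u≢w i)) (join-onˡ (u≢w i))

      L : Fin 4 → Line
      L = L₀ ∷ L₁ ∷ cross

      u₀≢u₁ : u zero ≢ u 1ᶠ
      u₀≢u₁ eq with PointsOn.injective u-choice eq
      ... | ()

      w₀≢w₁ : w zero ≢ w 1ᶠ
      w₀≢w₁ eq with PointsOn.injective w-choice eq
      ... | ()

      L₀L₁-vertex : ∀ {y} → y on L₀ → y on L₁ → y ≡ P₀
      L₀L₁-vertex y-on₀ y-on₁ = point-unique L₀≢L₁ y-on₀ y-on₁ P₀-on-L₀ P₀-on-L₁

      no-line-through-all-but : ∀ d {y} → (∀ x → x ≢ d → y on L x) → ⊥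
      no-line-through-all-but zero on-L =
        w₀≢w₁ (trans (sym (on-cross-L₁ (on-L 1ᶠ (λ ())) (on-L 2ᶠ (λ ()))))
                     (on-cross-L₁ (on-L 1ᶠ (λ ())) (on-L 3ᶠ (λ ()))))
      no-line-through-all-but 1ᶠ on-L =
        u₀≢u₁ (trans (sym (on-cross-L₀ (on-L zero (λ ())) (on-L 2ᶠ (λ ()))))
                     (on-cross-L₀ (on-L zero (λ ())) (on-L 3ᶠ (λ ()))))
      no-line-through-all-but 2ᶠ on-L = u≢P₀ 1ᶠ (sym (on-cross-L₀ P₀-on-L₀
        (subst (_on cross 1ᶠ) (L₀L₁-vertex (on-L zero (λ ())) (on-L 1ᶠ (λ ())))
               (on-L 3ᶠ (λ ())))))
      no-line-through-all-but 3ᶠ on-L = u≢P₀ zero (sym (on-cross-L₀ P₀-on-L₀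
        (subst (_on cross zero) (L₀L₁-vertex (on-L zero (λ ())) (on-L 1ᶠ (λ ())))
               (on-L 2ᶠ (λ ())))))

      no-three-concurrent : ∀ {y a b c} → a ≢ b → b ≢ c → a ≢ c → y on L a → y on L b → y on L c → ⊥
      no-three-concurrent {y} {a} {b} {c} a≢b b≢c a≢c y-a y-b y-c =
        no-line-through-all-but (proj₁ missing) λ x x≢d → on-L (proj₂ missing x x≢d)
        where
        missing : ∃ λ d → ∀ x → x ≢ d → x ≡ a ⊎ x ≡ b ⊎ x ≡ c
        missing = missing-index a b c a≢b b≢c a≢c
        on-L : ∀ {x} → x ≡ a ⊎ x ≡ b ⊎ x ≡ c → y on L x
        on-L (inj₁ refl)        = y-a
        on-L (inj₂ (inj₁ refl)) = y-b
        on-L (inj₂ (inj₂ refl)) = y-c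

      L≢L : ∀ {a b} → a ≢ b → L a ≢ L b
      L≢L {a} {b} a≢b La≡Lb = by-cases (L a ≟ L c)
        where
        c : Fin 4
        c = proj₁ (third-index a b)
        c≢a : c ≢ a
        c≢a = proj₁ (proj₂ (third-index a b))
        c≢b : c ≢ b
        c≢b = proj₂ (proj₂ (third-index a b))
        concurrent : ∀ {y} → y on L a → y on L c → ⊥
        concurrent y-a y-c = no-three-concurrent a≢b (c≢b ∘ sym) (c≢a ∘ sym) y-a (subst (_ on_) La≡Lb y-a) y-c
        some-point : PointOn (L a) []
        some-point = pointOn (L a) [] (s≤s z≤n)
        by-cases : Dec (L a ≡ L c) → ⊥
        by-cases (yes La≡Lc) = concurrent (PointOn.on-line some-point) (subst (_ on_) La≡Lc (PointOn.on-line some-point))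
        by-cases (no La≢Lc)  = concurrent (meet-onˡ La≢Lc) (meet-onʳ La≢Lc)

      record PointOnlyOn (a : Fin 4) {j} (extra : Fin j → Point) : Set where
        field
          point  : Point
          on-L   : point on L a
          off-L  : ∀ {b} → a ≢ b → ¬ point on L b
          avoids : ∀ i → extra i ≢ point

      pointOnlyOn : ∀ a {j} (extra : Fin j → Point) → j + 3 < suc q → PointOnlyOn a extra
      pointOnlyOn a {j} extra fits = record
        { point = PointOn.point choice ; on-L = PointOn.on-line choice ; off-L = off-L
        ; avoids = λ i → PointOn.avoids choice (i ↑ˡ 3) ∘ trans (cong [ extra , vertex ]′ (splitAt-↑ˡ j i 3)) }
        where
        vertex : Fin 3 → Point
        vertex = meet (L a) ∘ L ∘ punchIn a
        choice : PointOn (L a) (extra ++ vertex)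
        choice = pointOn (L a) (extra ++ vertex) fits
        off-L : ∀ {b} → a ≢ b → ¬ PointOn.point choice on L b
        off-L a≢b on-b = PointOn.avoids choice (j ↑ʳ punchOut a≢b)
          (trans (cong [ extra , vertex ]′ (splitAt-↑ʳ j 3 (punchOut a≢b)))
                 (trans (cong (meet (L a) ∘ L) (punchIn-punchOut a≢b))
                        (sym (meet-unique (L≢L a≢b) (PointOn.on-line choice) on-b))))

      e′ : ∀ a → PointOnlyOn a []
      e′ a = pointOnlyOn a [] (n<1+q (s≤s (s≤s (s≤s z≤n))))

      M : Line
      M = join (PointOnlyOn.point (e′ zero)) (PointOnlyOn.point (e′ 1ᶠ))

      e₃ : PointOnlyOn 3ᶠ (meet (L 3ᶠ) M ∷ [])
      e₃ = pointOnlyOn _ _ (n<1+q (s≤s (s≤s (s≤s (s≤s z≤n)))))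

      e : Fin 4 → Point
      e = PointOnlyOn.point (e′ zero) ∷ PointOnlyOn.point (e′ 1ᶠ) ∷ PointOnlyOn.point (e′ 2ᶠ)
            ∷ PointOnlyOn.point e₃ ∷ []

      e-on-L : ∀ a → e a on L a
      e-on-L zero = PointOnlyOn.on-L (e′ zero)
      e-on-L 1ᶠ   = PointOnlyOn.on-L (e′ 1ᶠ)
      e-on-L 2ᶠ   = PointOnlyOn.on-L (e′ 2ᶠ)
      e-on-L 3ᶠ   = PointOnlyOn.on-L e₃

      e-off-L : ∀ {a b} → a ≢ b → ¬ e a on L b
      e-off-L {zero} = PointOnlyOn.off-L (e′ zero)
      e-off-L {1ᶠ}   = PointOnlyOn.off-L (e′ 1ᶠ)
      e-off-L {2ᶠ}   = PointOnlyOn.off-L (e′ 2ᶠ)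
      e-off-L {3ᶠ}   = PointOnlyOn.off-L e₃

      e₃-not-on-M : ¬ e 3ᶠ on M
      e₃-not-on-M e₃-on = PointOnlyOn.avoids e₃ zero (sym (meet-unique L₃≢M (e-on-L _) e₃-on))
        where
        e₀≢e₁ : e zero ≢ e 1ᶠ
        e₀≢e₁ = ≢-by-line (e-on-L zero) (e-off-L {1ᶠ} {zero} (λ ()))
        L₃≢M : L 3ᶠ ≢ M
        L₃≢M = ≢-by-point (join-onˡ e₀≢e₁) (e-off-L {zero} {3ᶠ} (λ ())) ∘ sym

    configuration : Configuration
    configuration = record
      { L = L ; no-three-concurrent = no-three-concurrent ; e = e
      ; e-on-L = e-on-L ; e-not-on-L = e-off-L ; e₃-not-on-e₀e₁ = e₃-not-on-M }

  minimal-percolating-time-three : q ≡ 5 →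
    Σ (Subset (size q)) λ A → Percolation.MinimalPercolating Π 4 A
                              × Percolation.iter Π 4 2 A ≢ ⊤ × Percolation.iter Π 4 3 A ≡ ⊤
  minimal-percolating-time-three q≡5 = TimeThree.A q≡5 cfg , TimeThree.minimal-time-three q≡5 cfg
    where
    cfg : Configuration
    cfg = Construction.configuration q≡5

open import Data.Nat using (zero; suc; z≤n; s≤s; _≟_)
open import Data.Nat.Properties using (+-cancelʳ-≤; ≤-trans; ≤-reflexive; m≤m+n; ≤∧≢⇒<)
open import Data.Nat.Tactic.RingSolver using (solve-∀)
open import Data.Product using (_,_)
open import Data.Sum using (_⊎_; inj₁; inj₂)
open import Function using (_∘_)
open import Relation.Binary.PropositionalEquality using (refl; subst; sym)
open import Relation.Nullary using (yes; no)

quadrilateral-or-pencil : ∀ {q} s → 5 + 3 * s ≤ q → (s ≡ 0 × q ≡ 5) ⊎ 6 + 2 * s ≤ q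
quadrilateral-or-pencil {q} zero 5≤q with q ≟ 5
... | yes q≡5 = inj₁ (refl , q≡5)
... | no q≢5  = inj₂ (≤∧≢⇒< 5≤q (q≢5 ∘ sym))
quadrilateral-or-pencil (suc s) 8+3s≤q = inj₂ (≤-trans (≤-trans (m≤m+n _ s) (≤-reflexive (arithmetic s))) 8+3s≤q)
  where
  arithmetic : ∀ s → 6 + 2 * suc s + s ≡ 5 + 3 * suc s
  arithmetic = solve-∀

proposition14 : ∀ {q : ℕ} (Π : ProjectivePlane q) (r : ℕ) → 4 ≤ r → 3 * r ≤ q + 7 →
    Σ (Subset (size q)) λ A →
      Percolation.MinimalPercolating Π r A
      × Percolation.iter Π r 2 A ≢ ⊤
      × Percolation.iter Π r 3 A ≡ ⊤
proposition14 {q} Π (suc (suc (suc (suc s)))) (s≤s (s≤s (s≤s (s≤s z≤n)))) 3r≤q+7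
  with quadrilateral-or-pencil s (+-cancelʳ-≤ 7 (5 + 3 * s) q (subst (_≤ q + 7) (arithmetic s) 3r≤q+7))
  where
  arithmetic : ∀ s → 3 * (4 + s) ≡ (5 + 3 * s) + 7
  arithmetic = solve-∀
... | inj₁ (refl , q≡5) = Quadrilateral.minimal-percolating-time-three Π q≡5
... | inj₂ 6+2s≤q       = Pencil.minimal-percolating-time-three Π s 6+2s≤q
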